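{- Let $\phi\colon F\to G$ be an oddomorphism. If $F$ is a tree, then $G$ is a topological minor of $F$.
   Context: All graphs are finite, simple, undirected and loopless. Let $\phi\colon F\to G$ be a homomorphism. A vertex $a\in V(F)$ is $\phi$-odd (resp. $\phi$-even) if $|N_F(a)\cap\phi^{ -1}(v)|$ is odd (resp. even) for every $v\in N_G(\phi(a))$. $\phi$ is an oddomorphism if every vertex of $F$ is $\phi$-odd or $\phi$-even and every fibre $\phi^{ -1}(v)$, $v\in V(G)$, contains an odd number of $\phi$-odd vertices. A graph $G$ is a topological minor of $F$ if there is an injective map $\rho\colon V(G)\to V(F)$ and internally vertex-disjoint paths $(P_{vw})_{vw\in E(G)}$ in $F$ with $P_{vw}$ connecting $\rho(v)$ and $\rho(w)$. -}

module Defs where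

open import Data.Nat using (ℕ; zero; suc; _+_; _<_; _≤_)
open import Data.Nat.DivMod using (_%_)
open import Data.Fin using (Fin; toℕ)
open import Data.Bool using (Bool; true; false; _∧_; _∨_; if_then_else_)
open import Data.List using (List; []; _∷_; length)
open import Data.List.Membership.Propositional using (_∈_)
open import Data.List.Relation.Unary.Unique.Propositional using (Unique)
open import Data.Product using (Σ; ∃; _×_; _,_)
open import Data.Sum using (_⊎_)
open import Data.Empty using (⊥)
open import Relation.Nullary using (¬_)
open import Relation.Binary.PropositionalEquality using (_≡_; _≢_)
open import Function.Definitions using (Injective)

record Graph : Set where
  field
    n     : ℕ
    adj   : Fin n → Fin n → Bool
    sym   : ∀ i j → adj i j ≡ adj j i
    irrefl : ∀ i → adj i i ≡ false

open Graph public

V : Graph → Set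
V G = Fin (n G)

Adj : (G : Graph) → V G → V G → Set
Adj G a b = adj G a b ≡ true

count : (k : ℕ) → (Fin k → Bool) → ℕ
count zero    p = 0
count (suc k) p = (if p Data.Fin.zero then 1 else 0) + count k (λ i → p (Data.Fin.suc i))

allB : (k : ℕ) → (Fin k → Bool) → Bool
allB zero    p = true
allB (suc k) p = p Data.Fin.zero ∧ allB k (λ i → p (Data.Fin.suc i))

oddB : ℕ → Bool
oddB zero = false
oddB (suc m) = notB (oddB m)
  where
  notB : Bool → Bool
  notB true = false
  notB false = true

evenB : ℕ → Bool
evenB m = if oddB m then false else true

infix 4 _==_
_==_ : {k : ℕ} → Fin k → Fin k → Bool
_==_ {k} i j = eqℕ (toℕ i) (toℕ j)
  where
  eqℕ : ℕ → ℕ → Bool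
  eqℕ zero zero = true
  eqℕ zero (suc _) = false
  eqℕ (suc _) zero = false
  eqℕ (suc a) (suc b) = eqℕ a b

IsHom : (F G : Graph) → (V F → V G) → Set
IsHom F G φ = ∀ a b → Adj F a b → Adj G (φ a) (φ b)

nbFibre : (F G : Graph) → (V F → V G) → V F → V G → ℕ
nbFibre F G φ a v = count (n F) (λ b → adj F a b ∧ (φ b == v))

isOddVtx : (F G : Graph) → (V F → V G) → V F → Bool
isOddVtx F G φ a =
  allB (n G) (λ v → if adj G (φ a) v then oddB (nbFibre F G φ a v) else true)

isEvenVtx : (F G : Graph) → (V F → V G) → V F → Bool
isEvenVtx F G φ a =
  allB (n G) (λ v → if adj G (φ a) v then evenB (nbFibre F G φ a v) else true)

record IsOddomorphism (F G : Graph) (φ : V F → V G) : Set where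
  field
    hom        : IsHom F G φ
    oddOrEven  : ∀ a → (isOddVtx F G φ a ≡ true) ⊎ (isEvenVtx F G φ a ≡ true)
    fibreOdd   : ∀ v → oddB (count (n F) (λ a → (φ a == v) ∧ isOddVtx F G φ a)) ≡ true

data Walk (G : Graph) : V G → V G → Set where
  nil  : (a : V G) → Walk G a a
  cons : {a b c : V G} → Adj G a b → Walk G b c → Walk G a c

verts : {G : Graph} {a b : V G} → Walk G a b → List (V G)
verts (nil a) = a ∷ []
verts (cons {a} _ w) = a ∷ verts w

dropLast : {G : Graph} {a b : V G} → Walk G a b → List (V G)
dropLast (nil a) = []
dropLast (cons {a} _ w) = a ∷ dropLast w

inner : {G : Graph} {a b : V G} → Walk G a b → List (V G)
inner (nil a) = []
inner (cons _ w) = dropLast w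

record Path (G : Graph) (a b : V G) : Set where
  field
    walk     : Walk G a b
    distinct : Unique (verts walk)

open Path public

Connected : Graph → Set
Connected G = ∀ (a b : V G) → Walk G a b

HasCycle : Graph → Set
HasCycle G = Σ (V G) λ a → Σ (V G) λ b → Σ (Path G a b) λ P →
  (3 ≤ length (verts (walk P))) × Adj G b a

IsTree : Graph → Set
IsTree G = (0 < n G) × Connected G × ¬ HasCycle G

-- G is a topological minor of F: an injective ρ : V(G) → V(F) and,
-- for every edge vw of G (indexed once, with v < w), a path P_vw in F
-- from ρ(v) to ρ(w); inner vertices of these paths avoid ρ(V(G)) and
-- distinct paths have no inner vertex in common.
record TopMinorWitness (G F : Graph) : Set where
  field
    ρ      : V G → V F
    ρ-inj  : Injective _≡_ _≡_ ρ
    P      : (v w : V G) → toℕ v < toℕ w → Adj G v w → Path F (ρ v) (ρ w)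
    innerAvoidsBranch : ∀ v w (o : toℕ v < toℕ w) (e : Adj G v w) (u : V G) →
      ¬ (ρ u ∈ inner (walk (P v w o e)))
    innerDisjoint : ∀ v w (o : toℕ v < toℕ w) (e : Adj G v w)
                      v' w' (o' : toℕ v' < toℕ w') (e' : Adj G v' w') →
      (v ≢ v' ⊎ w ≢ w') → ∀ x →
      x ∈ inner (walk (P v w o e)) → ¬ (x ∈ inner (walk (P v' w' o' e')))

IsTopologicalMinor : (G F : Graph) → Set
IsTopologicalMinor G F = TopMinorWitness G F

-- Induction on |U| for a region W ⊆ V(F) over U ⊆ V(G): W is connected, closed under F-edges
-- into U, mapped onto U, and every fibre over U contains an odd number of odd vertices of W
-- (initially U = V(G) and W = V(F)).  A vertex x of W farthest from a fixed vertex has only one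
-- neighbour in W, so x is odd and ℓ = φ(x) is a pendant vertex of G[U], attached to some v.
-- The handshake lemma in F says that for K ⊆ V(F) and an edge uu' of G, the numbers of odd
-- vertices of K over u and over u' have different parities exactly when an odd number of
-- F-edges over uu' leave K.  Root F at an odd ℓ-vertex of W and let t be a deepest vertex of W
-- whose parent lies over ℓ and whose subtree holds an odd number of odd v-vertices.  The
-- component of t in W − φ⁻¹(ℓ) is then a region over U − ℓ, in which G[U − ℓ] embeds by
-- induction.  Finally ℓ is attached by a path from the branch vertex of v that leaves the
-- component at once: up to the root if that branch vertex is t, and otherwise down through an
-- ℓ-child, below which the handshake lemma and the maximality of t provide an odd ℓ-vertex.

module Submission where

open import Defs hiding (sym)

open import Algebra.Bundles using (CommutativeRing)
import Algebra.Properties.CommutativeMonoid.Sum as MonoidSum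
open import Data.Bool using (Bool; true; false; _∧_; _∨_; not; _xor_; if_then_else_)
open import Data.Bool.Properties
  using (∧-conicalˡ; ∧-conicalʳ; ∧-comm; ∧-identityʳ; ∧-zeroʳ; ∨-comm; ∨-identityʳ; ∨-zeroʳ;
         not-involutive; xor-identityʳ; xor-same; xor-∧-commutativeRing)
  renaming (_≟_ to _≟ᵇ_)
open import Data.Empty using (⊥; ⊥-elim)
open import Data.Fin using (Fin; zero; suc; toℕ; fromℕ<)
open import Data.Fin.Properties using (_≟_; any?; all?; ¬∀⟶∃¬)
import Data.Fin.Properties as Finₚ
open import Data.List using (List; []; _∷_; _++_; _∷ʳ_; length; reverse; filter; allFin)
import Data.List.Extrema.Nat as Extrema
open import Data.List.Membership.Propositional using (_∈_; _∉_)
open import Data.List.Membership.Propositional.Properties using (∈-++⁺ˡ; ∈-++⁺ʳ; ∈-++⁻; ∈-filter⁺; ∈-allFin)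
open import Data.List.Properties using (unfold-reverse)
open import Data.List.Relation.Unary.All using (lookup)
open import Data.List.Relation.Unary.All.Properties using (all-filter; ¬Any⇒All¬)
open import Data.List.Relation.Unary.Any using (here; there)
import Data.List.Relation.Unary.Any.Properties as Any
open import Data.List.Relation.Unary.AllPairs using ([]; _∷_)
open import Data.List.Relation.Unary.Unique.Propositional using (Unique)
open import Data.List.Relation.Unary.Unique.Propositional.Properties using (++⁺; Unique[x∷xs]⇒x∉xs)
open import Data.Nat using (ℕ; zero; suc; _+_; _≤_; _<_; z≤n; s≤s)
open import Data.Nat.Properties
  using (+-suc; +-mono-≤; ≤-refl; ≤-reflexive; ≤-trans; ≤-antisym; ≤-total; ≤-pred; n≤0⇒n≡0; n≤1+n;
         <-irrefl; <-asym; ≤-<-trans; <-≤-trans; ≰⇒>; suc-injective)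
  renaming (_≤?_ to _≤ℕ?_)
open import Data.Product using (Σ; ∃; _×_; _,_; proj₁; proj₂)
open import Data.Sum using (_⊎_; inj₁; inj₂)
open import Relation.Nullary using (¬_; Dec; yes; no; does; contradiction)
open import Relation.Nullary.Decidable using (_⊎-dec_; _×-dec_; _→-dec_; ¬?; map′; dec-true; dec-false)
open import Relation.Binary.PropositionalEquality

∧-trueˡ : ∀ {a b} → a ∧ b ≡ true → a ≡ true
∧-trueˡ {a} {b} = ∧-conicalˡ a b

∧-trueʳ : ∀ {a b} → a ∧ b ≡ true → b ≡ true
∧-trueʳ {a} {b} = ∧-conicalʳ a b

∧-true : ∀ {a b} → a ≡ true → b ≡ true → a ∧ b ≡ true
∧-true refl refl = refl

not-true : ∀ {a} → not a ≡ true → a ≡ false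
not-true {false} _ = refl

not-false : ∀ {a} → a ≡ false → not a ≡ true
not-false refl = refl

¬true : ∀ {a} → ¬ (a ≡ true) → a ≡ false
¬true {true} h = ⊥-elim (h refl)
¬true {false} _ = refl

false≢true : ∀ {a} → a ≡ false → a ≡ true → ⊥
false≢true refl ()

xor-false⇒≡ : ∀ {a b} → a xor b ≡ false → a ≡ b
xor-false⇒≡ {false} {false} _ = refl
xor-false⇒≡ {true} {true} _ = refl

∧-cong-true : ∀ b {x y} → (b ≡ true → x ≡ y) → b ∧ x ≡ b ∧ y
∧-cong-true true h = h refl
∧-cong-true false _ = refl

∧-shuffle : ∀ a b c o → ((a ∧ b) ∧ o) ∧ c ≡ (a ∧ b ∧ c) ∧ o
∧-shuffle false b c o = refl
∧-shuffle true false c o = refl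
∧-shuffle true true c o = ∧-comm o c

does⇒ : ∀ {p} {P : Set p} (d : Dec P) → does d ≡ true → P
does⇒ (yes p) _ = p

does-false⇒ : ∀ {p} {P : Set p} (d : Dec P) → does d ≡ false → ¬ P
does-false⇒ (no ¬p) _ = ¬p

==-refl : ∀ {k} (i : Fin k) → (i == i) ≡ true
==-refl zero = refl
==-refl (suc i) = ==-refl i

==⇒≡ : ∀ {k} (i j : Fin k) → (i == j) ≡ true → i ≡ j
==⇒≡ zero zero _ = refl
==⇒≡ (suc i) (suc j) e = cong suc (==⇒≡ i j e)

≡⇒== : ∀ {k} {i j : Fin k} → i ≡ j → (i == j) ≡ true
≡⇒== {i = i} refl = ==-refl i

≢⇒==-false : ∀ {k} {i j : Fin k} → i ≢ j → (i == j) ≡ false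
≢⇒==-false {i = i} {j} i≢j = ¬true (λ e → i≢j (==⇒≡ i j e))

==-false⇒≢ : ∀ {k} (i j : Fin k) → (i == j) ≡ false → i ≢ j
==-false⇒≢ i .i e refl = false≢true e (==-refl i)

allB-true : ∀ k (p : Fin k → Bool) → allB k p ≡ true → ∀ i → p i ≡ true
allB-true (suc k) p h zero = ∧-trueˡ h
allB-true (suc k) p h (suc i) = allB-true k (λ j → p (suc j)) (∧-trueʳ {p zero} h) i

oddB-suc : ∀ m → oddB (suc m) ≡ not (oddB m)
oddB-suc m with oddB m
... | true = refl
... | false = refl

oddB-+ : ∀ m n → oddB (m + n) ≡ oddB m xor oddB n
oddB-+ zero n = refl
oddB-+ (suc m) n rewrite oddB-suc (m + n) | oddB-suc m | oddB-+ m n with oddB m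
... | true = not-involutive (oddB n)
... | false = refl

evenB⇒¬oddB : ∀ m → evenB m ≡ true → oddB m ≡ false
evenB⇒¬oddB m e with oddB m
... | false = refl

module ⊕ = MonoidSum (CommutativeRing.+-commutativeMonoid xor-∧-commutativeRing)

-- Opaque so that the unifier treats `parity p` as rigid and can solve for `p`;
-- the same reason makes several later definitions opaque.
opaque
  parity : ∀ {k} → (Fin k → Bool) → Bool
  parity = ⊕.sum

  oddB-count : ∀ k (p : Fin k → Bool) → oddB (count k p) ≡ parity p
  oddB-count zero p = refl
  oddB-count (suc k) p =
    trans (oddB-+ (if p zero then 1 else 0) _) (cong₂ _xor_ (oddB-indicator (p zero)) (oddB-count k _))
    where
    oddB-indicator : ∀ b → oddB (if b then 1 else 0) ≡ b
    oddB-indicator true = refl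
    oddB-indicator false = refl

  parity-cong : ∀ {k} {p q : Fin k → Bool} → (∀ i → p i ≡ q i) → parity p ≡ parity q
  parity-cong = ⊕.sum-cong-≗

  parity-xor : ∀ {k} (p q : Fin k → Bool) → parity (λ i → p i xor q i) ≡ parity p xor parity q
  parity-xor = ⊕.∑-distrib-+

  parity-comm : ∀ {k m} (M : Fin k → Fin m → Bool) →
    parity (λ i → parity (M i)) ≡ parity (λ j → parity (λ i → M i j))
  parity-comm = ⊕.∑-comm

  parity-none : ∀ {k} {p : Fin k → Bool} → (∀ i → p i ≡ false) → parity p ≡ false
  parity-none {zero} h = refl
  parity-none {suc k} h rewrite h zero = parity-none (λ i → h (suc i))

  parity-single : ∀ {k} {p : Fin k → Bool} (i : Fin k) → (∀ j → j ≢ i → p j ≡ false) → parity p ≡ p i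
  parity-single {suc k} {p} zero h =
    trans (cong (p zero xor_) (parity-none (λ j → h (suc j) (λ ())))) (xor-identityʳ (p zero))
  parity-single {suc k} (suc i) h rewrite h zero (λ ()) =
    parity-single i (λ j j≢i → h (suc j) (λ e → j≢i (Finₚ.suc-injective e)))

  parity-witness : ∀ {k} (p : Fin k → Bool) → parity p ≡ true → ∃ λ i → p i ≡ true
  parity-witness {suc k} p h with p zero in e
  ... | true = zero , e
  ... | false with parity-witness (λ i → p (suc i)) h
  ...   | i , pi = suc i , pi

  parity-symmetric : ∀ {k} (M : Fin k → Fin k → Bool) → (∀ i j → M i j ≡ M j i) → (∀ i → M i i ≡ false) →
    parity (λ i → parity (M i)) ≡ false
  parity-symmetric {zero} M sym-M diag = refl
  parity-symmetric {suc k} M sym-M diag =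
    begin
      (M zero zero xor A) xor parity (λ i → M (suc i) zero xor parity (λ j → M (suc i) (suc j)))
    ≡⟨ cong₂ (λ d s → (d xor A) xor s) (diag zero)
         (parity-xor (λ i → M (suc i) zero) (λ i → parity (λ j → M (suc i) (suc j)))) ⟩
      A xor (parity (λ i → M (suc i) zero) xor parity (λ i → parity (λ j → M (suc i) (suc j))))
    ≡⟨ cong₂ (λ c s → A xor (c xor s)) (parity-cong (λ i → sym-M (suc i) zero))
         (parity-symmetric (λ i j → M (suc i) (suc j)) (λ i j → sym-M (suc i) (suc j)) (λ i → diag (suc i))) ⟩
      A xor (A xor false)
    ≡⟨ cong (A xor_) (xor-identityʳ A) ⟩
      A xor A
    ≡⟨ xor-same A ⟩
      false
    ∎
    where
    open ≡-Reasoning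
    A : Bool
    A = parity (λ j → M zero (suc j))

parity-split : ∀ {k} (p q : Fin k → Bool) →
  parity p ≡ parity (λ i → p i ∧ q i) xor parity (λ i → p i ∧ not (q i))
parity-split p q = trans (parity-cong (λ i → split (p i) (q i))) (parity-xor (λ i → p i ∧ q i) (λ i → p i ∧ not (q i)))
  where
  split : ∀ a b → a ≡ (a ∧ b) xor (a ∧ not b)
  split false b = refl
  split true true = refl
  split true false = refl

parity-∧ˡ : ∀ {k} b (p : Fin k → Bool) → parity (λ i → b ∧ p i) ≡ b ∧ parity p
parity-∧ˡ true p = refl
parity-∧ˡ false p = parity-none (λ _ → refl)

parity-partition : ∀ {k m} (X : Fin k → Bool) (K : Fin m → Bool) (Y : Fin m → Fin k → Bool) →
  (∀ {z} → X z ≡ true → ∃ λ q → K q ≡ true × Y q z ≡ true) →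
  (∀ {z q q'} → X z ≡ true → K q ≡ true → Y q z ≡ true → K q' ≡ true → Y q' z ≡ true → q ≡ q') →
  parity X ≡ parity (λ q → K q ∧ parity (λ z → Y q z ∧ X z))
parity-partition X K Y covered unique = begin
  parity X
    ≡⟨ parity-cong owner ⟩
  parity (λ z → parity (λ q → K q ∧ (Y q z ∧ X z)))
    ≡⟨ parity-comm (λ z q → K q ∧ (Y q z ∧ X z)) ⟩
  parity (λ q → parity (λ z → K q ∧ (Y q z ∧ X z)))
    ≡⟨ parity-cong (λ q → parity-∧ˡ (K q) (λ z → Y q z ∧ X z)) ⟩
  parity (λ q → K q ∧ parity (λ z → Y q z ∧ X z))
    ∎
  where
  open ≡-Reasoning
  owner : ∀ z → X z ≡ parity (λ q → K q ∧ (Y q z ∧ X z))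
  owner z with X z in Xz
  ... | false = sym (parity-none (λ q → trans (cong (K q ∧_) (∧-zeroʳ (Y q z))) (∧-zeroʳ (K q))))
  ... | true with covered Xz
  ...   | q₀ , Kq₀ , Yq₀ = sym (trans (parity-single q₀ others) (cong₂ _∧_ Kq₀ (cong (_∧ true) Yq₀)))
    where
    others : ∀ q → q ≢ q₀ → K q ∧ (Y q z ∧ true) ≡ false
    others q q≢q₀ = ¬true λ h →
      q≢q₀ (unique Xz (∧-trueˡ h) (trans (sym (∧-identityʳ (Y q z))) (∧-trueʳ {K q} h)) Kq₀ Yq₀)

count-cong : ∀ k {p q : Fin k → Bool} → (∀ i → p i ≡ q i) → count k p ≡ count k q
count-cong zero h = refl
count-cong (suc k) h rewrite h zero = cong (_ +_) (count-cong k (λ i → h (suc i)))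

count-remove : ∀ k (p : Fin k → Bool) (i : Fin k) → p i ≡ true →
  count k p ≡ suc (count k (λ j → p j ∧ not (j == i)))
count-remove (suc k) p zero pi rewrite pi =
  cong suc (count-cong k (λ j → sym (∧-identityʳ (p (suc j)))))
count-remove (suc k) p (suc i) pi rewrite ∧-identityʳ (p zero) | count-remove k (λ j → p (suc j)) i pi =
  +-suc _ _

module _ {k} (p : Fin k → Bool) (f : Fin k → ℕ) {i₀ : Fin k} (pi₀ : p i₀ ≡ true) where

  private
    candidates : List (Fin k)
    candidates = filter (λ i → p i ≟ᵇ true) (allFin k)

    candidate : ∀ {j} → p j ≡ true → j ∈ candidates
    candidate {j} = ∈-filter⁺ (λ i → p i ≟ᵇ true) (∈-allFin j)

  opaque
    argmax : ∃ λ i → p i ≡ true × (∀ j → p j ≡ true → f j ≤ f i)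
    argmax = Extrema.argmax f i₀ candidates ,
             Extrema.argmax-all f pi₀ (all-filter (λ i → p i ≟ᵇ true) (allFin k)) ,
             λ j pj → lookup (Extrema.f[xs]≤f[argmax] i₀ candidates) (candidate pj)

    argmin : ∃ λ i → p i ≡ true × (∀ j → p j ≡ true → f i ≤ f j)
    argmin = Extrema.argmin f i₀ candidates ,
             Extrema.argmin-all f pi₀ (all-filter (λ i → p i ≟ᵇ true) (allFin k)) ,
             λ j pj → lookup (Extrema.f[argmin]≤f[xs] i₀ candidates) (candidate pj)

Unique-∷ : ∀ {A : Set} {x : A} {xs : List A} → x ∉ xs → Unique xs → Unique (x ∷ xs)
Unique-∷ x∉xs u = ¬Any⇒All¬ _ x∉xs ∷ u

Unique-++⁻ˡ : ∀ {A : Set} (xs : List A) {ys : List A} → Unique (xs ++ ys) → Unique xs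
Unique-++⁻ˡ [] u = []
Unique-++⁻ˡ (x ∷ xs) (x∉ ∷ u) =
  Unique-∷ (λ m → Unique[x∷xs]⇒x∉xs (x∉ ∷ u) (∈-++⁺ˡ m)) (Unique-++⁻ˡ xs u)

Unique-++-disjoint : ∀ {A : Set} (xs : List A) {ys : List A} → Unique (xs ++ ys) →
  ∀ {v} → v ∈ xs → v ∉ ys
Unique-++-disjoint (x ∷ xs) u (here refl) m = Unique[x∷xs]⇒x∉xs u (∈-++⁺ʳ xs m)
Unique-++-disjoint (x ∷ xs) (_ ∷ u) (there m₁) m₂ = Unique-++-disjoint xs u m₁ m₂

Unique-reverse : ∀ {A : Set} {xs : List A} → Unique xs → Unique (reverse xs)
Unique-reverse {xs = []} u = u
Unique-reverse {xs = x ∷ xs} u@(_ ∷ u′) rewrite unfold-reverse x xs =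
  ++⁺ (Unique-reverse u′) (Unique-∷ (λ ()) [])
      (λ { (m , here refl) → Unique[x∷xs]⇒x∉xs u (Any.reverse⁻ m) })

module Walks (G : Graph) where

  adj-sym : ∀ {a b} → Adj G a b → Adj G b a
  adj-sym {a} {b} e = trans (Graph.sym G b a) e

  adj-irrefl : ∀ {a} → ¬ Adj G a a
  adj-irrefl {a} e with trans (sym (Graph.irrefl G a)) e
  ... | ()

  len : ∀ {a b} → Walk G a b → ℕ
  len (nil _) = 0
  len (cons _ w) = suc (len w)

  infixr 5 _++ʷ_

  _++ʷ_ : ∀ {a b c} → Walk G a b → Walk G b c → Walk G a c
  nil _ ++ʷ w₂ = w₂
  cons e w₁ ++ʷ w₂ = cons e (w₁ ++ʷ w₂)

  verts-++ʷ : ∀ {a b c} (w₁ : Walk G a b) (w₂ : Walk G b c) → verts (w₁ ++ʷ w₂) ≡ dropLast w₁ ++ verts w₂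
  verts-++ʷ (nil _) w₂ = refl
  verts-++ʷ (cons _ w₁) w₂ = cong (_ ∷_) (verts-++ʷ w₁ w₂)

  verts≡dropLast∷ʳ : ∀ {a b} (w : Walk G a b) → verts w ≡ dropLast w ∷ʳ b
  verts≡dropLast∷ʳ (nil _) = refl
  verts≡dropLast∷ʳ (cons _ w) = cong (_ ∷_) (verts≡dropLast∷ʳ w)

  length-verts : ∀ {a b} (w : Walk G a b) → length (verts w) ≡ suc (len w)
  length-verts (nil _) = refl
  length-verts (cons _ w) = cong suc (length-verts w)

  len-++ʷ : ∀ {a b c} (w₁ : Walk G a b) (w₂ : Walk G b c) → len (w₁ ++ʷ w₂) ≡ len w₁ + len w₂
  len-++ʷ (nil _) w₂ = refl
  len-++ʷ (cons _ w₁) w₂ = cong suc (len-++ʷ w₁ w₂)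

  start∈verts : ∀ {a b} (w : Walk G a b) → a ∈ verts w
  start∈verts (nil _) = here refl
  start∈verts (cons _ _) = here refl

  end∈verts : ∀ {a b} (w : Walk G a b) → b ∈ verts w
  end∈verts w rewrite verts≡dropLast∷ʳ w = ∈-++⁺ʳ (dropLast w) (here refl)

  dropLast⊆verts : ∀ {a b} (w : Walk G a b) {x} → x ∈ dropLast w → x ∈ verts w
  dropLast⊆verts w m rewrite verts≡dropLast∷ʳ w = ∈-++⁺ˡ m

  inner⊆verts : ∀ {a b} (w : Walk G a b) {x} → x ∈ inner w → x ∈ verts w
  inner⊆verts (cons _ w) m = there (dropLast⊆verts w m)

  Unique-dropLast : ∀ {a b} (w : Walk G a b) → Unique (verts w) → Unique (dropLast w)
  Unique-dropLast w u = Unique-++⁻ˡ (dropLast w) (subst Unique (verts≡dropLast∷ʳ w) u)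

  end∉dropLast : ∀ {a b} (w : Walk G a b) → Unique (verts w) → b ∉ dropLast w
  end∉dropLast w u m = Unique-++-disjoint (dropLast w) (subst Unique (verts≡dropLast∷ʳ w) u) m (here refl)

  start∉inner : ∀ {a b} (w : Walk G a b) → Unique (verts w) → a ∉ inner w
  start∉inner (cons _ w) u m = Unique[x∷xs]⇒x∉xs u (dropLast⊆verts w m)

  end∉inner : ∀ {a b} (w : Walk G a b) → Unique (verts w) → b ∉ inner w
  end∉inner (cons _ w) (_ ∷ u) m = end∉dropLast w u m

  reverseʷ : ∀ {a b} → Walk G a b → Walk G b a
  reverseʷ (nil a) = nil a
  reverseʷ (cons e w) = reverseʷ w ++ʷ cons (adj-sym e) (nil _)

  verts-snoc : ∀ {a b c} (w : Walk G a b) (e : Adj G b c) → verts (w ++ʷ cons e (nil c)) ≡ verts w ∷ʳ c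
  verts-snoc (nil _) e = refl
  verts-snoc (cons _ w) e = cong (_ ∷_) (verts-snoc w e)

  verts-reverseʷ : ∀ {a b} (w : Walk G a b) → verts (reverseʷ w) ≡ reverse (verts w)
  verts-reverseʷ (nil a) = refl
  verts-reverseʷ {a} (cons e w) = begin
    verts (reverseʷ w ++ʷ cons (adj-sym e) (nil a))  ≡⟨ verts-snoc (reverseʷ w) (adj-sym e) ⟩
    verts (reverseʷ w) ∷ʳ a                           ≡⟨ cong (_∷ʳ a) (verts-reverseʷ w) ⟩
    reverse (verts w) ∷ʳ a                            ≡⟨ unfold-reverse a (verts w) ⟨
    reverse (a ∷ verts w)                             ∎
    where open ≡-Reasoning

  ∈-verts-reverseʷ⁻ : ∀ {a b} (w : Walk G a b) {x} → x ∈ verts (reverseʷ w) → x ∈ verts w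
  ∈-verts-reverseʷ⁻ w m = Any.reverse⁻ (subst (_ ∈_) (verts-reverseʷ w) m)

  reverseᵖ : ∀ {a b} → Path G a b → Path G b a
  reverseᵖ P = record
    { walk = reverseʷ (walk P)
    ; distinct = subst Unique (sym (verts-reverseʷ (walk P))) (Unique-reverse (distinct P))
    }

  WalkWithin : (V G → Bool) → V G → V G → Set
  WalkWithin X a b = Σ (Walk G a b) λ w → ∀ {x} → x ∈ verts w → X x ≡ true

  _++ᵂ_ : ∀ {X a b c} → WalkWithin X a b → WalkWithin X b c → WalkWithin X a c
  _++ᵂ_ {X} (w₁ , in₁) (w₂ , in₂) =
    w₁ ++ʷ w₂ , λ m → inside (∈-++⁻ (dropLast w₁) (subst (_ ∈_) (verts-++ʷ w₁ w₂) m))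
    where
    inside : ∀ {x} → x ∈ dropLast w₁ ⊎ x ∈ verts w₂ → X x ≡ true
    inside (inj₁ m) = in₁ (dropLast⊆verts w₁ m)
    inside (inj₂ m) = in₂ m

least : (P : ℕ → Set) → (∀ k → Dec (P k)) → ∀ {m} → P m → ∃ λ k → P k × (∀ j → j < k → ¬ P j)
least P P? {zero} pm = zero , pm , λ _ ()
least P P? {suc m} pm with P? zero
... | yes p0 = zero , p0 , λ _ ()
... | no ¬p0 with least (λ k → P (suc k)) (λ k → P? (suc k)) pm
...   | k , pk , below = suc k , pk , λ { zero _ → ¬p0 ; (suc j) (s≤s j<k) → below j j<k }

module RootedTree (F : Graph) (conn : Connected F) (acyclic : ¬ HasCycle F) (r : V F) where

  open Walks F

  Within : ℕ → V F → Set
  Within zero z = z ≡ r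
  Within (suc k) z = Within k z ⊎ ∃ λ y → Adj F z y × Within k y

  within? : ∀ k z → Dec (Within k z)
  within? zero z = z ≟ r
  within? (suc k) z = within? k z ⊎-dec any? (λ y → (adj F z y ≟ᵇ true) ×-dec within? k y)

  walk⇒within : ∀ {z} (w : Walk F z r) → Within (len w) z
  walk⇒within (nil _) = refl
  walk⇒within (cons e w) = inj₂ (_ , e , walk⇒within w)

  private
    shortest : ∀ z → ∃ λ k → Within k z × (∀ j → j < k → ¬ Within j z)
    shortest z = least (λ k → Within k z) (λ k → within? k z) (walk⇒within (conn z r))

  opaque
    depth : V F → ℕ
    depth z = proj₁ (shortest z)

    within-depth : ∀ z → Within (depth z) z
    within-depth z = proj₁ (proj₂ (shortest z))

    depth≤ : ∀ {z k} → Within k z → depth z ≤ k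
    depth≤ {z} {k} h with depth z ≤ℕ? k
    ... | yes le = le
    ... | no nle = contradiction h (proj₂ (proj₂ (shortest z)) k (≰⇒> nle))

  depth-root : depth r ≡ 0
  depth-root = n≤0⇒n≡0 (depth≤ {k = 0} refl)

  depth≡0⇒root : ∀ {z} → depth z ≡ 0 → z ≡ r
  depth≡0⇒root {z} d = subst (λ k → Within k z) d (within-depth z)

  depth-adj : ∀ {z y} → Adj F z y → depth z ≤ suc (depth y)
  depth-adj e = depth≤ (inj₂ (_ , e , within-depth _))

  private
    parent? : ∀ z → (z ≡ r) ⊎ (∃ λ y → Adj F z y × depth z ≡ suc (depth y))
    parent? z with depth z in d
    ... | zero = inj₁ (depth≡0⇒root d)
    ... | suc k with subst (λ k → Within k z) d (within-depth z)
    ...   | inj₁ closer = ⊥-elim (<-irrefl refl (subst (_≤ k) d (depth≤ closer)))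
    ...   | inj₂ (y , e , y-within) = inj₂ (y , e , cong suc (≤-antisym k≤y (depth≤ y-within)))
      where
      k≤y : k ≤ depth y
      k≤y = ≤-pred (subst (_≤ suc (depth y)) d (depth-adj e))

  par : V F → V F
  par z with parent? z
  ... | inj₁ _ = r
  ... | inj₂ (y , _) = y

  par-adj : ∀ {z} → z ≢ r → Adj F z (par z)
  par-adj {z} z≢r with parent? z
  ... | inj₁ z≡r = contradiction z≡r z≢r
  ... | inj₂ (_ , e , _) = e

  depth-par : ∀ {z} → z ≢ r → depth z ≡ suc (depth (par z))
  depth-par {z} z≢r with parent? z
  ... | inj₁ z≡r = contradiction z≡r z≢r
  ... | inj₂ (_ , _ , d) = d

  depth-induction : ∀ {p} (P : V F → Set p) → P r → (∀ {z} → z ≢ r → P (par z) → P z) → ∀ z → P z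
  depth-induction P base step z = go (depth z) z ≤-refl
    where
    go : ∀ k z → depth z ≤ k → P z
    go k z d with z ≟ r
    ... | yes refl = base
    go zero z d | no z≢r = contradiction (depth≡0⇒root (n≤0⇒n≡0 d)) z≢r
    go (suc k) z d | no z≢r = step z≢r (go k (par z) (≤-pred (subst (_≤ suc k) (depth-par z≢r) d)))

  infix 4 _≼_

  data _≼_ : V F → V F → Set where
    ≼-refl : ∀ {z} → z ≼ z
    ≼-step : ∀ {s z} → z ≢ r → s ≼ par z → s ≼ z

  par≢ : ∀ {z} → z ≢ r → par z ≢ z
  par≢ {z} z≢r pz≡z = <-irrefl (cong depth pz≡z) (subst (depth (par z) <_) (sym (depth-par z≢r)) ≤-refl)

  par-≼ : ∀ {z} → z ≢ r → par z ≼ z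
  par-≼ z≢r = ≼-step z≢r ≼-refl

  ≼-par : ∀ {s z} → s ≼ z → s ≢ z → s ≼ par z
  ≼-par ≼-refl s≢z = contradiction refl s≢z
  ≼-par (≼-step _ h) _ = h

  ≼-trans : ∀ {s t z} → s ≼ t → t ≼ z → s ≼ z
  ≼-trans h ≼-refl = h
  ≼-trans h (≼-step z≢r h') = ≼-step z≢r (≼-trans h h')

  root-≼ : ∀ z → r ≼ z
  root-≼ = depth-induction (r ≼_) ≼-refl ≼-step

  ≼-root : ∀ {s} → s ≼ r → s ≡ r
  ≼-root ≼-refl = refl
  ≼-root (≼-step r≢r _) = contradiction refl r≢r

  ≼-depth : ∀ {s z} → s ≼ z → depth s ≤ depth z
  ≼-depth ≼-refl = ≤-refl
  ≼-depth {z = z} (≼-step z≢r h) =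
    ≤-trans (≼-depth h) (subst (depth (par z) ≤_) (sym (depth-par z≢r)) (n≤1+n (depth (par z))))

  ≼-depth-< : ∀ {s z} → s ≼ z → s ≢ z → depth s < depth z
  ≼-depth-< ≼-refl s≢z = contradiction refl s≢z
  ≼-depth-< (≼-step z≢r h) _ = subst (_ <_) (sym (depth-par z≢r)) (s≤s (≼-depth h))

  ≼-depth-≡ : ∀ {s z} → s ≼ z → depth s ≡ depth z → s ≡ z
  ≼-depth-≡ {s} {z} h d with s ≟ z
  ... | yes s≡z = s≡z
  ... | no s≢z = contradiction d (λ d' → <-irrefl d' (≼-depth-< h s≢z))

  ≼-linear : ∀ {s t z} → s ≼ z → t ≼ z → s ≼ t ⊎ t ≼ s
  ≼-linear ≼-refl t≼z = inj₂ t≼z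
  ≼-linear (≼-step z≢r s≼pz) ≼-refl = inj₁ (≼-step z≢r s≼pz)
  ≼-linear (≼-step _ s≼pz) (≼-step _ t≼pz) = ≼-linear s≼pz t≼pz

  ≼-by-depth : ∀ {s t z} → s ≼ z → t ≼ z → depth s ≤ depth t → s ≼ t
  ≼-by-depth s≼z t≼z d with ≼-linear s≼z t≼z
  ... | inj₁ s≼t = s≼t
  ... | inj₂ t≼s rewrite ≼-depth-≡ t≼s (≤-antisym (≼-depth t≼s) d) = ≼-refl

  _≼?_ : ∀ s z → Dec (s ≼ z)
  s ≼? z = depth-induction (λ z → Dec (s ≼ z)) (map′ (λ { refl → ≼-refl }) ≼-root (s ≟ r)) step z
    where
    step : ∀ {z} → z ≢ r → Dec (s ≼ par z) → Dec (s ≼ z)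
    step {z} z≢r s≼?pz with s ≟ z
    ... | yes refl = yes ≼-refl
    ... | no s≢z = map′ (≼-step z≢r) (λ h → ≼-par h s≢z) s≼?pz

  opaque
    isAnc : V F → V F → Bool
    isAnc s z = does (s ≼? z)

    ≼⇒isAnc : ∀ {s z} → s ≼ z → isAnc s z ≡ true
    ≼⇒isAnc {s} {z} = dec-true (s ≼? z)

    ⋠⇒isAnc : ∀ {s z} → ¬ s ≼ z → isAnc s z ≡ false
    ⋠⇒isAnc {s} {z} = dec-false (s ≼? z)

    isAnc⇒≼ : ∀ {s z} → isAnc s z ≡ true → s ≼ z
    isAnc⇒≼ {s} {z} h with s ≼? z
    ... | yes s≼z = s≼z

  ascent : ∀ {s z} → s ≼ z → Σ (Path F z s) λ P → ∀ {x} → x ∈ verts (walk P) → s ≼ x × x ≼ z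
  ascent {s} ≼-refl = record { walk = nil s ; distinct = Unique-∷ (λ ()) [] } , λ { (here refl) → ≼-refl , ≼-refl }
  ascent {z = z} (≼-step z≢r s≼pz) with ascent s≼pz
  ... | P , between = record { walk = cons (par-adj z≢r) (walk P) ; distinct = Unique-∷ z∉P (distinct P) } ,
                      λ { (here refl) → ≼-step z≢r s≼pz , ≼-refl
                        ; (there m) → proj₁ (between m) , ≼-trans (proj₂ (between m)) (par-≼ z≢r) }
    where
    z∉P : z ∉ verts (walk P)
    z∉P m = <-irrefl refl (≤-<-trans (≼-depth (proj₂ (between m))) (subst (depth (par z) <_) (sym (depth-par z≢r)) ≤-refl))

  descent : ∀ {s z} → s ≼ z → Σ (Path F s z) λ P → ∀ {x} → x ∈ verts (walk P) → s ≼ x × x ≼ z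
  descent s≼z with ascent s≼z
  ... | P , between = reverseᵖ P , λ m → between (∈-verts-reverseʷ⁻ (walk P) m)

  ParentEdge : V F → V F → Set
  ParentEdge z y = z ≢ r × par z ≡ y

  parentEdge? : ∀ z y → Dec (ParentEdge z y)
  parentEdge? z y = ¬? (z ≟ r) ×-dec (par z ≟ y)

  depth-child : ∀ {q c} → ParentEdge c q → depth c ≡ suc (depth q)
  depth-child (c≢r , pc≡q) = trans (depth-par c≢r) (cong (λ x → suc (depth x)) pc≡q)

  private
    ancestor-neighbour : ∀ {a b} → Adj F a b → a ≼ b → a ≢ b → ParentEdge b a
    ancestor-neighbour e ≼-refl a≢b = contradiction refl a≢b
    ancestor-neighbour {a} {b} e (≼-step b≢r a≼pb) _ =
      b≢r , sym (≼-depth-≡ a≼pb (≤-antisym (≼-depth a≼pb) (≤-pred pb<a+1)))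
      where
      pb<a+1 : suc (depth (par b)) ≤ suc (depth a)
      pb<a+1 = subst (_≤ suc (depth a)) (depth-par b≢r) (depth-adj (adj-sym e))

    len-pos : ∀ {a b} → a ≢ b → (w : Walk F a b) → 1 ≤ len w
    len-pos a≢a (nil _) = contradiction refl a≢a
    len-pos _ (cons _ _) = s≤s z≤n

    cycle : ∀ {a b} → Adj F a b → ¬ ParentEdge a b → ¬ ParentEdge b a → HasCycle F
    cycle {a} {b} e ¬ab ¬ba = a , b , record { walk = walk up ++ʷ walk down ; distinct = distinct-up++down } ,
      subst (3 ≤_) (sym (trans (length-verts (walk up ++ʷ walk down)) (cong suc (len-++ʷ (walk up) (walk down)))))
        (s≤s (+-mono-≤ (len-pos a≢m (walk up)) (len-pos m≢b (walk down)))) ,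
      adj-sym e
      where
      common : V F → Bool
      common s = isAnc s a ∧ isAnc s b
      lca = argmax common depth {r} (∧-true (≼⇒isAnc (root-≼ a)) (≼⇒isAnc (root-≼ b)))
      m = proj₁ lca
      m≼a = isAnc⇒≼ (∧-trueˡ (proj₁ (proj₂ lca)))
      m≼b = isAnc⇒≼ (∧-trueʳ (proj₁ (proj₂ lca)))
      up = proj₁ (ascent m≼a)
      down = proj₁ (descent m≼b)
      a≢m : a ≢ m
      a≢m a≡m = ¬ba (ancestor-neighbour e (subst (_≼ b) (sym a≡m) m≼b) (λ { refl → adj-irrefl e }))
      m≢b : m ≢ b
      m≢b m≡b = ¬ab (ancestor-neighbour (adj-sym e) (subst (_≼ a) m≡b m≼a) (λ { refl → adj-irrefl e }))
      distinct-up++down : Unique (verts (walk up ++ʷ walk down))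
      distinct-up++down =
        subst Unique (sym (verts-++ʷ (walk up) (walk down)))
          (++⁺ (Unique-dropLast (walk up) (distinct up)) (distinct down) disjoint)
        where
        disjoint : ∀ {x} → x ∈ dropLast (walk up) × x ∈ verts (walk down) → ⊥
        disjoint {x} (x∈up , x∈down) = <-irrefl refl (≤-<-trans x≤m (≼-depth-< m≼x m≢x))
          where
          m≼x = proj₁ (proj₂ (ascent m≼a) (dropLast⊆verts (walk up) x∈up))
          m≢x : m ≢ x
          m≢x refl = end∉dropLast (walk up) (distinct up) x∈up
          x≤m : depth x ≤ depth m
          x≤m = proj₂ (proj₂ lca) x (∧-true (≼⇒isAnc (proj₂ (proj₂ (ascent m≼a) (dropLast⊆verts (walk up) x∈up))))
                                            (≼⇒isAnc (proj₂ (proj₂ (descent m≼b) x∈down))))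

  edge-parent : ∀ {a b} → Adj F a b → ParentEdge a b ⊎ ParentEdge b a
  edge-parent {a} {b} e with parentEdge? a b | parentEdge? b a
  ... | yes ab | _ = inj₁ ab
  ... | no _ | yes ba = inj₂ ba
  ... | no ¬ab | no ¬ba = ⊥-elim (acyclic (cycle e ¬ab ¬ba))

  edge-leaving-subtree : ∀ {s u u'} → Adj F u u' → s ≼ u → ¬ s ≼ u' → u ≡ s × u' ≡ par s
  edge-leaving-subtree {s} {u} e s≼u s⋠u' with edge-parent e
  ... | inj₂ (u'≢r , pu'≡u) = contradiction (≼-step u'≢r (subst (s ≼_) (sym pu'≡u) s≼u)) s⋠u'
  ... | inj₁ (u≢r , pu≡u') with s ≟ u
  ...   | yes refl = refl , sym pu≡u'
  ...   | no s≢u = contradiction (subst (s ≼_) pu≡u' (≼-par s≼u s≢u)) s⋠u'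

  walk-leaving-subtree : ∀ {s u x} (w : Walk F u x) → s ≼ u → ¬ s ≼ x → par s ∈ verts w
  walk-leaving-subtree (nil _) s≼u s⋠u = contradiction s≼u s⋠u
  walk-leaving-subtree {s} (cons {b = u'} e w) s≼u s⋠x with s ≼? u'
  ... | yes s≼u' = there (walk-leaving-subtree w s≼u' s⋠x)
  ... | no s⋠u' = there (subst (_∈ verts w) (proj₂ (edge-leaving-subtree e s≼u s⋠u')) (start∈verts w))

  parent-closed : (X : V F → Bool) → (∀ {z z'} → X z ≡ true → X z' ≡ true → WalkWithin X z z') → X r ≡ true →
    ∀ {z} → X z ≡ true → z ≢ r → X (par z) ≡ true
  parent-closed X connected Xr Xz z≢r with connected Xz Xr
  ... | w , inside = inside (walk-leaving-subtree w ≼-refl (λ z≼r → z≢r (≼-root z≼r)))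

  child-towards : ∀ {q z} → q ≼ z → q ≢ z → ∃ λ c → ParentEdge c q × c ≼ z
  child-towards ≼-refl q≢z = contradiction refl q≢z
  child-towards {q} {z} (≼-step z≢r q≼pz) _ with q ≟ par z
  ... | yes refl = z , (z≢r , refl) , ≼-refl
  ... | no q≢pz with child-towards q≼pz q≢pz
  ...   | c , pe , c≼pz = c , pe , ≼-step z≢r c≼pz

module Oddomorphism (F G : Graph) (φ : V F → V G) (odm : IsOddomorphism F G φ) where

  open IsOddomorphism odm
  open Walks G using (adj-sym; adj-irrefl)

  opaque
    isOdd : V F → Bool
    isOdd = isOddVtx F G φ

    neighbour-parity : ∀ {a w} → Adj G (φ a) w → parity (λ b → adj F a b ∧ (φ b == w)) ≡ isOdd a
    neighbour-parity {a} {w} e = trans (sym (oddB-count (n F) _)) (by-kind (oddOrEven a))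
      where
      at-w : ∀ {P : V G → Bool} → allB (n G) (λ v → if adj G (φ a) v then P v else true) ≡ true → P w ≡ true
      at-w {P} h = subst (λ b → (if b then P w else true) ≡ true) e (allB-true (n G) _ h w)
      by-kind : (isOdd a ≡ true) ⊎ (isEvenVtx F G φ a ≡ true) → oddB (nbFibre F G φ a w) ≡ isOdd a
      by-kind (inj₁ odd) = trans (at-w odd) (sym odd)
      by-kind (inj₂ even) = trans nb-even (sym (¬true (λ odd → false≢true nb-even (at-w odd))))
        where
        nb-even : oddB (nbFibre F G φ a w) ≡ false
        nb-even = evenB⇒¬oddB (nbFibre F G φ a w) (at-w even)

    isOdd-isOddVtx : ∀ a → isOdd a ≡ isOddVtx F G φ a
    isOdd-isOddVtx a = refl

  odd⇒neighbour-in-fibre : ∀ {a w} → isOdd a ≡ true → Adj G (φ a) w → ∃ λ y → Adj F a y × φ y ≡ w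
  odd⇒neighbour-in-fibre {a} {w} od e with parity-witness _ (trans (neighbour-parity e) od)
  ... | y , h = y , ∧-trueˡ h , ==⇒≡ (φ y) w (∧-trueʳ {adj F a y} h)

  oddIn : V G → V F → Bool
  oddIn u a = (φ a == u) ∧ isOdd a

  oddParity : (V F → Bool) → V G → Bool
  oddParity K u = parity (λ a → K a ∧ oddIn u a)

  private
    fibres-disjoint : ∀ {u u'} → Adj G u u' → ∀ z → (φ z == u) ≡ true → (φ z == u') ≡ false
    fibres-disjoint uu' z zu =
      ¬true (λ zu' → adj-irrefl (subst (λ x → Adj G x _) (trans (sym (==⇒≡ (φ z) _ zu)) (==⇒≡ (φ z) _ zu')) uu'))

  opaque
    over : V G → V G → V F → V F → Bool
    over u u' z y = adj F z y ∧ ((φ z == u) ∧ (φ y == u') ∨ (φ z == u') ∧ (φ y == u))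

    over-sym : ∀ u u' z y → over u u' z y ≡ over u u' y z
    over-sym u u' z y =
      cong₂ _∧_ (Graph.sym F z y)
        (trans (∨-comm ((φ z == u) ∧ (φ y == u')) ((φ z == u') ∧ (φ y == u)))
               (cong₂ _∨_ (∧-comm (φ z == u') (φ y == u)) (∧-comm (φ z == u) (φ y == u'))))

    over-irrefl : ∀ u u' z → over u u' z z ≡ false
    over-irrefl u u' z = cong (_∧ _) (Graph.irrefl F z)

    over⇒ : ∀ {u u' z y} → over u u' z y ≡ true → Adj F z y × (φ y ≡ u' ⊎ φ y ≡ u)
    over⇒ {u} {u'} {z} {y} h with (φ z == u) ∧ (φ y == u') in e
    ... | true = ∧-trueˡ h , inj₁ (==⇒≡ (φ y) u' (∧-trueʳ {φ z == u} e))
    ... | false = ∧-trueˡ h , inj₂ (==⇒≡ (φ y) u (∧-trueʳ {φ z == u'} (∧-trueʳ {adj F z y} h)))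

    over-intro : ∀ {u u' z y} → Adj F z y → φ z ≡ u' → φ y ≡ u → over u u' z y ≡ true
    over-intro {u} {u'} {z} {y} e φz≡u' φy≡u =
      ∧-true e (subst (λ b → (φ z == u) ∧ (φ y == u') ∨ b ≡ true) (sym (∧-true (≡⇒== φz≡u') (≡⇒== φy≡u))) (∨-zeroʳ _))

    degree-parity : ∀ (K : V F → Bool) {u u'} → Adj G u u' → ∀ z →
      parity (λ y → K z ∧ over u u' z y) ≡ (K z ∧ oddIn u z) xor (K z ∧ oddIn u' z)
    degree-parity K {u} {u'} uu' z with K z
    ... | false = parity-none (λ _ → refl)
    ... | true with φ z == u in zu | φ z == u' in zu'
    ...   | true | true = contradiction zu' (λ h → false≢true (fibres-disjoint uu' z zu) h)
    ...   | true | false =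
            trans (parity-cong (λ y → cong (adj F z y ∧_) (∨-identityʳ _)))
                  (trans (neighbour-parity (subst (λ x → Adj G x u') (sym (==⇒≡ (φ z) u zu)) uu')) (sym (xor-identityʳ _)))
    ...   | false | true = neighbour-parity (subst (λ x → Adj G x u) (sym (==⇒≡ (φ z) u' zu')) (adj-sym uu'))
    ...   | false | false = parity-none (λ y → ∧-zeroʳ (adj F z y))

  handshake : ∀ (K : V F → Bool) {u u'} → Adj G u u' →
    oddParity K u xor oddParity K u' ≡ parity (λ z → parity (λ y → (K z ∧ over u u' z y) ∧ not (K y)))
  handshake K {u} {u'} uu' = begin
    oddParity K u xor oddParity K u'
      ≡⟨ parity-xor (λ z → K z ∧ oddIn u z) (λ z → K z ∧ oddIn u' z) ⟨
    parity (λ z → (K z ∧ oddIn u z) xor (K z ∧ oddIn u' z))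
      ≡⟨ parity-cong (λ z → degree-parity K uu' z) ⟨
    parity (λ z → parity (λ y → K z ∧ over u u' z y))
      ≡⟨ parity-cong (λ z → parity-split (λ y → K z ∧ over u u' z y) K) ⟩
    parity (λ z → parity (inside z) xor parity (leaving z))
      ≡⟨ parity-xor (λ z → parity (inside z)) (λ z → parity (leaving z)) ⟩
    parity (λ z → parity (inside z)) xor parity (λ z → parity (leaving z))
      ≡⟨ cong (_xor parity (λ z → parity (leaving z))) (parity-symmetric inside inside-sym inside-irrefl) ⟩
    parity (λ z → parity (leaving z))
      ∎
    where
    open ≡-Reasoning
    inside leaving : V F → V F → Bool
    inside z y = (K z ∧ over u u' z y) ∧ K y
    leaving z y = (K z ∧ over u u' z y) ∧ not (K y)
    inside-sym : ∀ z y → inside z y ≡ inside y z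
    inside-sym z y rewrite over-sym u u' z y with K z | K y
    ... | true | true = refl
    ... | true | false = ∧-zeroʳ _
    ... | false | true = sym (∧-zeroʳ _)
    ... | false | false = refl
    inside-irrefl : ∀ z → inside z z ≡ false
    inside-irrefl z rewrite over-irrefl u u' z | ∧-zeroʳ (K z) = refl

  closed⇒parity-equal : ∀ (K : V F → Bool) {u u'} → Adj G u u' →
    (∀ {z y} → K z ≡ true → Adj F z y → φ y ≡ u' ⊎ φ y ≡ u → K y ≡ true) →
    oddParity K u ≡ oddParity K u'
  closed⇒parity-equal K {u} {u'} uu' closed =
    xor-false⇒≡ (trans (handshake K uu') (parity-none (λ z → parity-none (λ y → stays z y))))
    where
    stays : ∀ z y → (K z ∧ over u u' z y) ∧ not (K y) ≡ false
    stays z y with K z in Kz | over u u' z y in o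
    ... | false | _ = refl
    ... | true | false = refl
    ... | true | true with over⇒ o
    ...   | e , fibre rewrite closed Kz e fibre = refl

  single-exit⇒parity-differ : ∀ (K : V F → Bool) {u u'} → Adj G u u' → ∀ {z₀ y₀} →
    K z₀ ≡ true → over u u' z₀ y₀ ≡ true → K y₀ ≡ false →
    (∀ {z y} → K z ≡ true → over u u' z y ≡ true → K y ≡ false → z ≡ z₀ × y ≡ y₀) →
    oddParity K u xor oddParity K u' ≡ true
  single-exit⇒parity-differ K {u} {u'} uu' {z₀} {y₀} Kz₀ o₀ Ky₀ exit = begin
    oddParity K u xor oddParity K u'
      ≡⟨ handshake K uu' ⟩
    parity (λ z → parity (λ y → (K z ∧ over u u' z y) ∧ not (K y)))
      ≡⟨ parity-single z₀ elsewhere ⟩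
    parity (λ y → (K z₀ ∧ over u u' z₀ y) ∧ not (K y))
      ≡⟨ parity-single y₀ (λ y y≢y₀ → ¬true (λ h → y≢y₀ (proj₂ (exit′ h)))) ⟩
    (K z₀ ∧ over u u' z₀ y₀) ∧ not (K y₀)
      ≡⟨ cong₂ (λ a b → (a ∧ b) ∧ not (K y₀)) Kz₀ o₀ ⟩
    not (K y₀)
      ≡⟨ not-false Ky₀ ⟩
    true
      ∎
    where
    open ≡-Reasoning
    exit′ : ∀ {z y} → (K z ∧ over u u' z y) ∧ not (K y) ≡ true → z ≡ z₀ × y ≡ y₀
    exit′ {z} h = exit (∧-trueˡ (∧-trueˡ h)) (∧-trueʳ {K z} (∧-trueˡ h)) (not-true (∧-trueʳ {K z ∧ _} h))
    elsewhere : ∀ z → z ≢ z₀ → parity (λ y → (K z ∧ over u u' z y) ∧ not (K y)) ≡ false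
    elsewhere z z≢z₀ = parity-none (λ y → ¬true (λ h → z≢z₀ (proj₁ (exit′ h))))

module Embeddings (F G : Graph) (φ : V F → V G) (odm : IsOddomorphism F G φ) where

  open Oddomorphism F G φ odm
  open Walks F
  open Walks G using () renaming (adj-sym to adjᴳ-sym)

  record Region (U : V G → Bool) (W : V F → Bool) : Set where
    field
      image : ∀ {z} → W z ≡ true → U (φ z) ≡ true
      closed : ∀ {z y} → W z ≡ true → Adj F z y → U (φ y) ≡ true → W y ≡ true
      connected : ∀ {z z'} → W z ≡ true → W z' ≡ true → WalkWithin W z z'
      odd-fibres : ∀ {u} → U u ≡ true → oddParity W u ≡ true

  record Embedding (U : V G → Bool) (W : V F → Bool) : Set where
    field
      ρ : V G → V F
      ρ-in : ∀ {u} → U u ≡ true → W (ρ u) ≡ true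
      ρ-fibre : ∀ {u} → U u ≡ true → φ (ρ u) ≡ u
      ρ-odd : ∀ {u} → U u ≡ true → isOdd (ρ u) ≡ true
      path : ∀ {v w} → toℕ v < toℕ w → Adj G v w → U v ≡ true → U w ≡ true → Path F (ρ v) (ρ w)
      path-in : ∀ {v w} o e Uv Uw {x} → x ∈ verts (walk (path {v} {w} o e Uv Uw)) → W x ≡ true
      avoids-branches : ∀ {v w} o e Uv Uw {u} → U u ≡ true → ρ u ∉ inner (walk (path {v} {w} o e Uv Uw))
      disjoint : ∀ {v w v' w'} o e Uv Uw o' e' Uv' Uw' → v ≢ v' ⊎ w ≢ w' →
        ∀ {x} → x ∈ inner (walk (path {v} {w} o e Uv Uw)) → x ∉ inner (walk (path {v'} {w'} o' e' Uv' Uw'))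

  castᵖ : ∀ {a a' b b'} → a ≡ a' → b ≡ b' → Path F a b → Path F a' b'
  castᵖ refl refl P = P

  ∈-verts-castᵖ : ∀ {a a' b b'} (p : a ≡ a') (q : b ≡ b') (P : Path F a b) {x} →
    x ∈ verts (walk (castᵖ p q P)) → x ∈ verts (walk P)
  ∈-verts-castᵖ refl refl P m = m

  ∈-inner-castᵖ : ∀ {a a' b b'} (p : a ≡ a') (q : b ≡ b') (P : Path F a b) {x} →
    x ∈ inner (walk (castᵖ p q P)) → x ∈ inner (walk P)
  ∈-inner-castᵖ refl refl P m = m

  module PendantExtension
    {U : V G → Bool} {W C : V F → Bool} {ℓ v : V G}
    (pendant : ∀ {u} → U u ≡ true → Adj G ℓ u → u ≡ v)
    (v-kept : (U v ∧ not (v == ℓ)) ≡ true)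
    (C⊆W : ∀ {z} → C z ≡ true → W z ≡ true)
    (E : Embedding (λ u → U u ∧ not (u == ℓ)) C)
    {y : V F} (Wy : W y ≡ true) (y-odd : oddIn ℓ y ≡ true)
    (Q : Path F (Embedding.ρ E v) y)
    (Q-in : ∀ {x} → x ∈ verts (walk Q) → W x ≡ true)
    (Q-outside : ∀ {x} → x ∈ verts (walk Q) → x ≢ Embedding.ρ E v → C x ≡ false)
    where

    private
      module E = Embedding E

    U' : V G → Bool
    U' u = U u ∧ not (u == ℓ)

    a : V F
    a = E.ρ v

    kept : ∀ {u} → U u ≡ true → u ≢ ℓ → U' u ≡ true
    kept Uu u≢ℓ = ∧-true Uu (not-false (≢⇒==-false u≢ℓ))

    kept⇒≢ℓ : ∀ {u} → U' u ≡ true → u ≢ ℓ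
    kept⇒≢ℓ {u} h = ==-false⇒≢ u ℓ (not-true (∧-trueʳ {U u} h))

    φa : φ a ≡ v
    φa = E.ρ-fibre v-kept

    φy : φ y ≡ ℓ
    φy = ==⇒≡ (φ y) ℓ (∧-trueˡ y-odd)

    y∉C : C y ≡ false
    y∉C = Q-outside (end∈verts (walk Q)) (λ y≡a → kept⇒≢ℓ v-kept (trans (sym φa) (trans (cong φ (sym y≡a)) φy)))

    ρ : V G → V F
    ρ u = if u == ℓ then y else E.ρ u

    ρ-ℓ : ∀ {u} → u ≡ ℓ → y ≡ ρ u
    ρ-ℓ refl = cong (if_then y else E.ρ ℓ) (sym (==-refl ℓ))

    ρ-kept : ∀ {u} → U' u ≡ true → E.ρ u ≡ ρ u
    ρ-kept {u} h = cong (if_then y else E.ρ u) (sym (not-true (∧-trueʳ {U u} h)))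

    ρ-v : ∀ {u} → u ≡ v → a ≡ ρ u
    ρ-v refl = ρ-kept v-kept

    data EdgeKind (v' w' : V G) : Set where
      pendant-edge : (v' ≡ ℓ × w' ≡ v) ⊎ (v' ≡ v × w' ≡ ℓ) → EdgeKind v' w'
      kept-edge : U' v' ≡ true → U' w' ≡ true → EdgeKind v' w'

    kind : ∀ {v' w'} → Adj G v' w' → U v' ≡ true → U w' ≡ true → EdgeKind v' w'
    kind {v'} {w'} e Uv' Uw' with v' ≟ ℓ | w' ≟ ℓ
    ... | yes refl | _ = pendant-edge (inj₁ (refl , pendant Uw' e))
    ... | no v'≢ℓ | yes refl = pendant-edge (inj₂ (pendant Uv' (adjᴳ-sym e) , refl))
    ... | no v'≢ℓ | no w'≢ℓ = kept-edge (kept Uv' v'≢ℓ) (kept Uw' w'≢ℓ)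

    path-of : ∀ {v' w'} → toℕ v' < toℕ w' → Adj G v' w' → EdgeKind v' w' → Path F (ρ v') (ρ w')
    path-of o e (pendant-edge (inj₁ (p , q))) = castᵖ (ρ-ℓ p) (ρ-v q) (reverseᵖ Q)
    path-of o e (pendant-edge (inj₂ (p , q))) = castᵖ (ρ-v p) (ρ-ℓ q) Q
    path-of o e (kept-edge Uv' Uw') = castᵖ (ρ-kept Uv') (ρ-kept Uw') (E.path o e Uv' Uw')

    private
      pendant-inner : ∀ {v' w'} o e s {x} → x ∈ inner (walk (path-of {v'} {w'} o e (pendant-edge s))) →
        x ∈ verts (walk Q) × x ≢ a × x ≢ y
      pendant-inner o e (inj₁ (p , q)) m with ∈-inner-castᵖ (ρ-ℓ p) (ρ-v q) (reverseᵖ Q) m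
      ... | m' = ∈-verts-reverseʷ⁻ (walk Q) (inner⊆verts _ m') ,
                 (λ { refl → end∉inner (walk (reverseᵖ Q)) (distinct (reverseᵖ Q)) m' }) ,
                 (λ { refl → start∉inner (walk (reverseᵖ Q)) (distinct (reverseᵖ Q)) m' })
      pendant-inner o e (inj₂ (p , q)) m with ∈-inner-castᵖ (ρ-v p) (ρ-ℓ q) Q m
      ... | m' = inner⊆verts (walk Q) m' ,
                 (λ { refl → start∉inner (walk Q) (distinct Q) m' }) ,
                 (λ { refl → end∉inner (walk Q) (distinct Q) m' })

      pendant-outside : ∀ {v' w'} o e s {x} → x ∈ inner (walk (path-of {v'} {w'} o e (pendant-edge s))) → C x ≡ false
      pendant-outside o e s m with pendant-inner o e s m
      ... | x∈Q , x≢a , _ = Q-outside x∈Q x≢a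

      kept-inner : ∀ {v' w'} o e Uv' Uw' {x} → x ∈ inner (walk (path-of {v'} {w'} o e (kept-edge Uv' Uw'))) →
        x ∈ inner (walk (E.path o e Uv' Uw'))
      kept-inner o e Uv' Uw' = ∈-inner-castᵖ (ρ-kept Uv') (ρ-kept Uw') (E.path o e Uv' Uw')

      kept-inside : ∀ {v' w'} o e Uv' Uw' {x} → x ∈ inner (walk (path-of {v'} {w'} o e (kept-edge Uv' Uw'))) → C x ≡ true
      kept-inside o e Uv' Uw' m = E.path-in o e Uv' Uw' (inner⊆verts _ (kept-inner o e Uv' Uw' m))

      path-of-in : ∀ {v' w'} o e k {x} → x ∈ verts (walk (path-of {v'} {w'} o e k)) → W x ≡ true
      path-of-in o e (pendant-edge (inj₁ (p , q))) m =
        Q-in (∈-verts-reverseʷ⁻ (walk Q) (∈-verts-castᵖ (ρ-ℓ p) (ρ-v q) (reverseᵖ Q) m))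
      path-of-in o e (pendant-edge (inj₂ (p , q))) m = Q-in (∈-verts-castᵖ (ρ-v p) (ρ-ℓ q) Q m)
      path-of-in o e (kept-edge Uv' Uw') m =
        C⊆W (E.path-in o e Uv' Uw' (∈-verts-castᵖ (ρ-kept Uv') (ρ-kept Uw') (E.path o e Uv' Uw') m))

      y-avoided : ∀ {v' w'} o e k → y ∉ inner (walk (path-of {v'} {w'} o e k))
      y-avoided o e (pendant-edge s) m = proj₂ (proj₂ (pendant-inner o e s m)) refl
      y-avoided o e (kept-edge Uv' Uw') m = false≢true y∉C (kept-inside o e Uv' Uw' m)

      kept-avoided : ∀ {v' w'} o e k {u} → U' u ≡ true → E.ρ u ∉ inner (walk (path-of {v'} {w'} o e k))
      kept-avoided o e (pendant-edge s) Uu m = false≢true (pendant-outside o e s m) (E.ρ-in Uu)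
      kept-avoided o e (kept-edge Uv' Uw') Uu m = E.avoids-branches o e Uv' Uw' Uu (kept-inner o e Uv' Uw' m)

      path-of-avoids : ∀ {v' w'} o e k {u} → U u ≡ true → ρ u ∉ inner (walk (path-of {v'} {w'} o e k))
      path-of-avoids o e k {u} Uu with u ≟ ℓ
      ... | yes u≡ℓ = subst (_∉ _) (ρ-ℓ u≡ℓ) (y-avoided o e k)
      ... | no u≢ℓ = subst (_∉ _) (ρ-kept (kept Uu u≢ℓ)) (kept-avoided o e k (kept Uu u≢ℓ))

      same-pendant-edge : ∀ {v₁ w₁ v₂ w₂} → toℕ v₁ < toℕ w₁ → (v₁ ≡ ℓ × w₁ ≡ v) ⊎ (v₁ ≡ v × w₁ ≡ ℓ) →
        toℕ v₂ < toℕ w₂ → (v₂ ≡ ℓ × w₂ ≡ v) ⊎ (v₂ ≡ v × w₂ ≡ ℓ) → ¬ (v₁ ≢ v₂ ⊎ w₁ ≢ w₂)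
      same-pendant-edge _ (inj₁ (refl , refl)) _ (inj₁ (refl , refl)) = λ { (inj₁ d) → d refl ; (inj₂ d) → d refl }
      same-pendant-edge _ (inj₂ (refl , refl)) _ (inj₂ (refl , refl)) = λ { (inj₁ d) → d refl ; (inj₂ d) → d refl }
      same-pendant-edge o₁ (inj₁ (refl , refl)) o₂ (inj₂ (refl , refl)) = λ _ → <-asym o₁ o₂
      same-pendant-edge o₁ (inj₂ (refl , refl)) o₂ (inj₁ (refl , refl)) = λ _ → <-asym o₁ o₂

      path-of-disjoint : ∀ {v₁ w₁ v₂ w₂} o₁ e₁ k₁ o₂ e₂ k₂ → v₁ ≢ v₂ ⊎ w₁ ≢ w₂ →
        ∀ {x} → x ∈ inner (walk (path-of {v₁} {w₁} o₁ e₁ k₁)) → x ∉ inner (walk (path-of {v₂} {w₂} o₂ e₂ k₂))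
      path-of-disjoint o₁ e₁ (kept-edge a₁ b₁) o₂ e₂ (kept-edge a₂ b₂) d m₁ m₂ =
        E.disjoint o₁ e₁ a₁ b₁ o₂ e₂ a₂ b₂ d (kept-inner o₁ e₁ a₁ b₁ m₁) (kept-inner o₂ e₂ a₂ b₂ m₂)
      path-of-disjoint o₁ e₁ (kept-edge a₁ b₁) o₂ e₂ (pendant-edge s₂) d m₁ m₂ =
        false≢true (pendant-outside o₂ e₂ s₂ m₂) (kept-inside o₁ e₁ a₁ b₁ m₁)
      path-of-disjoint o₁ e₁ (pendant-edge s₁) o₂ e₂ (kept-edge a₂ b₂) d m₁ m₂ =
        false≢true (pendant-outside o₁ e₁ s₁ m₁) (kept-inside o₂ e₂ a₂ b₂ m₂)
      path-of-disjoint o₁ e₁ (pendant-edge s₁) o₂ e₂ (pendant-edge s₂) d m₁ m₂ = same-pendant-edge o₁ s₁ o₂ s₂ d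

      ρ-cases : (P : V G → V F → Set) → P ℓ y → (∀ {u} → U' u ≡ true → P u (E.ρ u)) →
        ∀ {u} → U u ≡ true → P u (ρ u)
      ρ-cases P at-ℓ at-kept {u} Uu with u ≟ ℓ
      ... | yes refl = subst (P ℓ) (ρ-ℓ refl) at-ℓ
      ... | no u≢ℓ = subst (P u) (ρ-kept (kept Uu u≢ℓ)) (at-kept (kept Uu u≢ℓ))

    extended : Embedding U W
    extended = record
      { ρ = ρ
      ; ρ-in = ρ-cases (λ _ z → W z ≡ true) Wy (λ h → C⊆W (E.ρ-in h))
      ; ρ-fibre = ρ-cases (λ u z → φ z ≡ u) φy E.ρ-fibre
      ; ρ-odd = ρ-cases (λ _ z → isOdd z ≡ true) (∧-trueʳ {φ y == ℓ} y-odd) E.ρ-odd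
      ; path = λ o e Uv' Uw' → path-of o e (kind e Uv' Uw')
      ; path-in = λ o e Uv' Uw' → path-of-in o e (kind e Uv' Uw')
      ; avoids-branches = λ o e Uv' Uw' → path-of-avoids o e (kind e Uv' Uw')
      ; disjoint = λ o₁ e₁ a₁ b₁ o₂ e₂ a₂ b₂ → path-of-disjoint o₁ e₁ (kind e₁ a₁ b₁) o₂ e₂ (kind e₂ a₂ b₂)
      }

module Pruning (F G : Graph) (φ : V F → V G) (odm : IsOddomorphism F G φ)
               (conn : Connected F) (acyclic : ¬ HasCycle F) where

  open Oddomorphism F G φ odm
  open Embeddings F G φ odm
  open Walks F using (adj-sym; start∈verts; WalkWithin; _++ᵂ_)
  open Walks G using () renaming (adj-sym to adjᴳ-sym; adj-irrefl to adjᴳ-irrefl)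
  open IsOddomorphism odm using (hom)

  record PendantVertex (U : V G → Bool) : Set where
    field
      ℓ v : V G
      ℓv : Adj G ℓ v
      Uℓ : U ℓ ≡ true
      Uv : U v ≡ true
      pendant : ∀ {u} → U u ≡ true → Adj G ℓ u → u ≡ v

  module _ {U W} (R : Region U W) (P : PendantVertex U) where

    open Region R
    open PendantVertex P

    private
      root : ∃ λ ys → W ys ∧ oddIn ℓ ys ≡ true
      root = parity-witness _ (odd-fibres Uℓ)

    ys : V F
    ys = proj₁ root

    open RootedTree F conn acyclic ys

    U' : V G → Bool
    U' u = U u ∧ not (u == ℓ)

    onℓ : V F → Bool
    onℓ z = φ z == ℓ

    W-ys : W ys ≡ true
    W-ys = ∧-trueˡ (proj₂ root)

    ys-odd : oddIn ℓ ys ≡ true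
    ys-odd = ∧-trueʳ {W ys} (proj₂ root)

    ℓ≢v : ℓ ≢ v
    ℓ≢v refl = adjᴳ-irrefl ℓv

    on-v⇒off-ℓ : ∀ {z} → φ z ≡ v → onℓ z ≡ false
    on-v⇒off-ℓ φz≡v = ≢⇒==-false (λ φz≡ℓ → ℓ≢v (trans (sym φz≡ℓ) φz≡v))

    kept⇒off-ℓ : ∀ {z} → U' (φ z) ≡ true → onℓ z ≡ false
    kept⇒off-ℓ {z} h = not-true (∧-trueʳ {U (φ z)} h)

    W-par : ∀ {z} → W z ≡ true → z ≢ ys → W (par z) ≡ true
    W-par = parent-closed W connected W-ys

    W-≼ : ∀ {s z} → W z ≡ true → s ≼ z → W s ≡ true
    W-≼ Wz ≼-refl = Wz
    W-≼ Wz (≼-step z≢ys s≼pz) = W-≼ (W-par Wz z≢ys) s≼pz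

    ℓ-neighbour-on-v : ∀ {q y} → onℓ q ≡ true → Adj F q y → U (φ y) ≡ true → φ y ≡ v
    ℓ-neighbour-on-v {q} {y} ℓq e Uy = pendant Uy (subst (λ x → Adj G x (φ y)) (==⇒≡ (φ q) ℓ ℓq) (hom q y e))

    parent-of-ℓ : ∀ {q} → W q ≡ true → onℓ q ≡ true → q ≢ ys → φ (par q) ≡ v
    parent-of-ℓ Wq ℓq q≢ys = ℓ-neighbour-on-v ℓq (par-adj q≢ys) (image (W-par Wq q≢ys))

    Clear : V F → V F → Set
    Clear t z = ∀ s → t ≼ s → s ≼ z → onℓ s ≡ false

    opaque
      clear? : ∀ t z → Dec (Clear t z)
      clear? t z = all? (λ s → (t ≼? s) →-dec ((s ≼? z) →-dec (onℓ s ≟ᵇ false)))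

    InComponent : V F → V F → Set
    InComponent t z = W z ≡ true × t ≼ z × Clear t z

    inComponent? : ∀ t z → Dec (InComponent t z)
    inComponent? t z = (W z ≟ᵇ true) ×-dec (t ≼? z) ×-dec clear? t z

    component : V F → V F → Bool
    component t z = W z ∧ isAnc t z ∧ does (clear? t z)

    component⇒ : ∀ {t z} → component t z ≡ true → InComponent t z
    component⇒ {t} {z} h =
      ∧-trueˡ h , isAnc⇒≼ (∧-trueˡ (∧-trueʳ {W z} h)) , does⇒ (clear? t z) (∧-trueʳ {isAnc t z} (∧-trueʳ {W z} h))

    ⇒component : ∀ {t z} → InComponent t z → component t z ≡ true
    ⇒component {t} {z} (Wz , t≼z , clear) = ∧-true Wz (∧-true (≼⇒isAnc t≼z) (dec-true (clear? t z) clear))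

    component-between : ∀ {t z x} → InComponent t z → x ≼ z → t ≼ x → InComponent t x
    component-between (Wz , t≼z , clear) x≼z t≼x = W-≼ Wz x≼z , t≼x , λ s t≼s s≼x → clear s t≼s (≼-trans s≼x x≼z)

    component-off-ℓ : ∀ {t z} → InComponent t z → onℓ z ≡ false
    component-off-ℓ (_ , t≼z , clear) = clear _ t≼z ≼-refl

    Top : V F → Set
    Top t = W t ≡ true × t ≢ ys × onℓ (par t) ≡ true

    top? : ∀ t → Dec (Top t)
    top? t = (W t ≟ᵇ true) ×-dec (¬? (t ≟ ys) ×-dec (onℓ (par t) ≟ᵇ true))

    top-on-v : ∀ {t} → Top t → φ t ≡ v
    top-on-v (Wt , t≢ys , ℓpt) = ℓ-neighbour-on-v ℓpt (adj-sym (par-adj t≢ys)) (image Wt)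

    module _ {t} (top-t : Top t) where

      component-closed : ∀ {z y} → InComponent t z → Adj F z y → U' (φ y) ≡ true → InComponent t y
      component-closed {z} {y} (Wz , t≼z , clear) e U'y with edge-parent e
      ... | inj₁ (z≢ys , pz≡y) with z ≟ t
      ...   | yes refl = ⊥-elim (false≢true (kept⇒off-ℓ U'y) (subst (λ x → onℓ x ≡ true) pz≡y (proj₂ (proj₂ top-t))))
      ...   | no z≢t = component-between (Wz , t≼z , clear) (subst (_≼ z) pz≡y (par-≼ z≢ys))
                         (subst (t ≼_) pz≡y (≼-par t≼z (λ t≡z → z≢t (sym t≡z))))
      component-closed {z} {y} (Wz , t≼z , clear) e U'y | inj₂ (y≢ys , py≡z) =
        closed Wz e (∧-trueˡ U'y) , ≼-trans t≼z z≼y , clear-y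
        where
        z≼y : z ≼ y
        z≼y = subst (_≼ y) py≡z (par-≼ y≢ys)
        clear-y : Clear t y
        clear-y s t≼s s≼y with s ≟ y
        ... | yes refl = kept⇒off-ℓ U'y
        ... | no s≢y = clear s t≼s (subst (s ≼_) py≡z (≼-par s≼y s≢y))

      component-connected : ∀ {z z'} → InComponent t z → InComponent t z' → WalkWithin (component t) z z'
      component-connected {z} {z'} cz cz' = up ++ᵂ down
        where
        up : WalkWithin (component t) z t
        up with ascent (proj₁ (proj₂ cz))
        ... | P , between = walk P , λ m → ⇒component (component-between cz (proj₂ (between m)) (proj₁ (between m)))
        down : WalkWithin (component t) t z'
        down with descent (proj₁ (proj₂ cz'))
        ... | P , between = walk P , λ m → ⇒component (component-between cz' (proj₂ (between m)) (proj₁ (between m)))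

      private
        kept-image : ∀ {x} → W x ≡ true → onℓ x ≡ false → U' (φ x) ≡ true
        kept-image Wx ¬ℓx = ∧-true (image Wx) (not-false ¬ℓx)

        walk-parity : ∀ {z z'} (w : Walk F z z') → (∀ {x} → x ∈ verts w → W x ≡ true) → φ z' ≡ v → onℓ z ≡ false →
          oddParity (component t) (φ z) ≡ oddParity (component t) v
        walk-parity (nil _) _ φz'≡v _ = cong (oddParity (component t)) φz'≡v
        walk-parity {z} (cons {b = z₁} e w) in-w φz'≡v ¬ℓz with φ z ≟ v
        ... | yes φz≡v = cong (oddParity (component t)) φz≡v
        ... | no φz≢v =
          trans (closed⇒parity-equal (component t) (hom z z₁ e) closure) (walk-parity w (λ m → in-w (there m)) φz'≡v ¬ℓz₁)
          where
          Wz = in-w (here refl)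
          Wz₁ = in-w (there (start∈verts w))
          ¬ℓz₁ : onℓ z₁ ≡ false
          ¬ℓz₁ = ¬true (λ ℓz₁ → φz≢v (ℓ-neighbour-on-v ℓz₁ (adj-sym e) (image Wz)))
          closure : ∀ {x y} → component t x ≡ true → Adj F x y → φ y ≡ φ z₁ ⊎ φ y ≡ φ z → component t y ≡ true
          closure cx e' (inj₁ p) =
            ⇒component (component-closed (component⇒ cx) e' (subst (λ u → U' u ≡ true) (sym p) (kept-image Wz₁ ¬ℓz₁)))
          closure cx e' (inj₂ p) =
            ⇒component (component-closed (component⇒ cx) e' (subst (λ u → U' u ≡ true) (sym p) (kept-image Wz ¬ℓz)))

      component-parity-constant : ∀ {u} → U' u ≡ true → oddParity (component t) u ≡ oddParity (component t) v
      component-parity-constant {u} U'u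
        with parity-witness _ (odd-fibres (∧-trueˡ U'u)) | parity-witness _ (odd-fibres Uv)
      ... | z , hz | z' , hz' with connected (∧-trueˡ hz) (∧-trueˡ hz')
      ...   | w , in-w = trans (cong (oddParity (component t)) (sym φz≡u)) (walk-parity w in-w φz'≡v ¬ℓz)
        where
        φz≡u : φ z ≡ u
        φz≡u = ==⇒≡ (φ z) u (∧-trueˡ (∧-trueʳ {W z} hz))
        φz'≡v : φ z' ≡ v
        φz'≡v = ==⇒≡ (φ z') v (∧-trueˡ (∧-trueʳ {W z'} hz'))
        ¬ℓz : onℓ z ≡ false
        ¬ℓz = subst (λ x → (x == ℓ) ≡ false) (sym φz≡u) (not-true (∧-trueʳ {U u} U'u))

      component-region : oddParity (component t) v ≡ true → Region U' (component t)
      component-region odd-v = record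
        { image = λ cz → kept-image (proj₁ (component⇒ cz)) (component-off-ℓ (component⇒ cz))
        ; closed = λ cz e U'y → ⇒component (component-closed (component⇒ cz) e U'y)
        ; connected = λ cz cz' → component-connected (component⇒ cz) (component⇒ cz')
        ; odd-fibres = λ U'u → trans (component-parity-constant U'u) odd-v
        }

    below : V F → V F → Bool
    below q z = W z ∧ isAnc q z

    vParity : V F → Bool
    vParity q = oddParity (below q) v

    Child : V F → V F → Set
    Child q c = W c ≡ true × ParentEdge c q

    child? : ∀ q c → Dec (Child q c)
    child? q c = (W c ≟ᵇ true) ×-dec parentEdge? c q

    child : V F → V F → Bool
    child q c = does (child? q c)

    below-restrict : ∀ {q c} → q ≼ c → ∀ z → isAnc c z ∧ (below q z ∧ oddIn v z) ≡ below c z ∧ oddIn v z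
    below-restrict {q} {c} q≼c z with c ≼? z
    ... | no c⋠z = outside (⋠⇒isAnc c⋠z)
      where
      outside : ∀ {a x} → a ≡ false → a ∧ x ≡ (W z ∧ a) ∧ oddIn v z
      outside refl = cong (_∧ oddIn v z) (sym (∧-zeroʳ (W z)))
    ... | yes c≼z = inside (≼⇒isAnc c≼z) (≼⇒isAnc (≼-trans q≼c c≼z))
      where
      inside : ∀ {a b} → a ≡ true → b ≡ true → a ∧ ((W z ∧ b) ∧ oddIn v z) ≡ (W z ∧ a) ∧ oddIn v z
      inside refl refl = refl

    vParity-ℓ : ∀ {q} → onℓ q ≡ true → vParity q ≡ parity (λ c → child q c ∧ vParity c)
    vParity-ℓ {q} ℓq = trans (parity-partition X (child q) isAnc covered unique) (parity-cong per-child)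
      where
      X : V F → Bool
      X z = below q z ∧ oddIn v z
      covered : ∀ {z} → X z ≡ true → ∃ λ c → child q c ≡ true × isAnc c z ≡ true
      covered {z} h with child-towards (isAnc⇒≼ (∧-trueʳ {W z} (∧-trueˡ h))) q≢z
        where
        q≢z : q ≢ z
        q≢z refl = false≢true (on-v⇒off-ℓ (==⇒≡ (φ q) v (∧-trueˡ (∧-trueʳ {below q q} h)))) ℓq
      ... | c , pe , c≼z =
        c , dec-true (child? q c) (W-≼ (∧-trueˡ (∧-trueˡ h)) c≼z , pe) ,
        ≼⇒isAnc c≼z
      unique : ∀ {z c c'} → X z ≡ true → child q c ≡ true → isAnc c z ≡ true →
        child q c' ≡ true → isAnc c' z ≡ true → c ≡ c'
      unique {z} {c} {c'} _ ch c≼z ch' c'≼z = ≼-depth-≡ c≼c' same-depth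
        where
        pe = proj₂ (does⇒ (child? q c) ch)
        pe' = proj₂ (does⇒ (child? q c') ch')
        same-depth = trans (depth-child pe) (sym (depth-child pe'))
        c≼c' = ≼-by-depth (isAnc⇒≼ c≼z) (isAnc⇒≼ c'≼z) (≤-reflexive same-depth)
      per-child : ∀ c → child q c ∧ parity (λ z → isAnc c z ∧ X z) ≡ child q c ∧ vParity c
      per-child c = ∧-cong-true (child q c) λ ch → parity-cong (below-restrict (q≼c ch))
        where
        q≼c : child q c ≡ true → q ≼ c
        q≼c ch = subst (_≼ c) (proj₂ pe) (par-≼ (proj₁ pe))
          where pe = proj₂ (does⇒ (child? q c) ch)

    Hanging : V F → V F → Set
    Hanging t q = W q ≡ true × onℓ q ≡ true × q ≢ ys × InComponent t (par q)

    hanging? : ∀ t q → Dec (Hanging t q)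
    hanging? t q = (W q ≟ᵇ true) ×-dec (onℓ q ≟ᵇ true) ×-dec ¬? (q ≟ ys) ×-dec inComponent? t (par q)

    hanging : V F → V F → Bool
    hanging t q = does (hanging? t q)

    hanging-below : ∀ {t q} → Hanging t q → t ≼ q
    hanging-below (_ , _ , q≢ys , _ , t≼pq , _) = ≼-trans t≼pq (par-≼ q≢ys)

    hanging-nested : ∀ {t q q'} → Hanging t q → Hanging t q' → q ≼ q' → q ≡ q'
    hanging-nested {q = q} {q'} h (_ , _ , _ , _ , _ , clear) q≼q' with q ≟ q'
    ... | yes q≡q' = q≡q'
    ... | no q≢q' = contradiction (proj₁ (proj₂ h)) (false≢true (clear q (hanging-below h) (≼-par q≼q' q≢q')))

    hanging-unique : ∀ {t q q' z} → Hanging t q → Hanging t q' → q ≼ z → q' ≼ z → q ≡ q'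
    hanging-unique {q = q} {q'} h h' q≼z q'≼z with ≤-total (depth q) (depth q')
    ... | inj₁ d = hanging-nested h h' (≼-by-depth q≼z q'≼z d)
    ... | inj₂ d = sym (hanging-nested h' h (≼-by-depth q'≼z q≼z d))

    topmost-ℓ : ∀ {t z} → Top t → W z ≡ true → t ≼ z → ¬ Clear t z → ∃ λ q → Hanging t q × q ≼ z
    topmost-ℓ {t} {z} top-t Wz t≼z ¬clear =
      q , (W-≼ Wz q≼z , ℓq , q≢ys , W-par (W-≼ Wz q≼z) q≢ys , ≼-par t≼q t≢q , clear-pq) , q≼z
      where
      ℓ-between : V F → Bool
      ℓ-between s = isAnc t s ∧ isAnc s z ∧ onℓ s
      witness : ∃ λ s → ℓ-between s ≡ true
      witness with ¬∀⟶∃¬ (n F) _ (λ s → (t ≼? s) →-dec ((s ≼? z) →-dec (onℓ s ≟ᵇ false))) ¬clear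
      ... | s , ¬s with t ≼? s | s ≼? z | onℓ s in ℓs
      ...   | yes t≼s | yes s≼z | true = s , ∧-true (≼⇒isAnc t≼s) (∧-true (≼⇒isAnc s≼z) ℓs)
      ...   | yes _ | yes _ | false = contradiction (λ _ _ → refl) ¬s
      ...   | yes _ | no s⋠z | _ = contradiction (λ _ s≼z → contradiction s≼z s⋠z) ¬s
      ...   | no t⋠s | _ | _ = contradiction (λ t≼s → contradiction t≼s t⋠s) ¬s
      shallowest = argmin ℓ-between depth (proj₂ witness)
      q = proj₁ shallowest
      hq = proj₁ (proj₂ shallowest)
      t≼q = isAnc⇒≼ (∧-trueˡ hq)
      q≼z = isAnc⇒≼ (∧-trueˡ (∧-trueʳ {isAnc t q} hq))
      ℓq = ∧-trueʳ {isAnc q z} (∧-trueʳ {isAnc t q} hq)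
      t≢q : t ≢ q
      t≢q t≡q = false≢true (on-v⇒off-ℓ (top-on-v top-t)) (subst (λ x → onℓ x ≡ true) (sym t≡q) ℓq)
      q≢ys : q ≢ ys
      q≢ys q≡ys = proj₁ (proj₂ top-t) (≼-root (subst (t ≼_) q≡ys t≼q))
      clear-pq : Clear t (par q)
      clear-pq s t≼s s≼pq = ¬true λ ℓs →
        <-irrefl refl (<-≤-trans (≤-<-trans (≼-depth s≼pq) (≼-depth-< (par-≼ q≢ys) (par≢ q≢ys)))
                                 (proj₂ (proj₂ shallowest) s
                                   (∧-true (≼⇒isAnc t≼s) (∧-true (≼⇒isAnc (≼-trans s≼pq (≼-trans (par-≼ q≢ys) q≼z))) ℓs))))

    vParity-top : ∀ {t} → Top t → vParity t ≡ oddParity (component t) v xor parity (λ q → hanging t q ∧ vParity q)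
    vParity-top {t} top-t = begin
      vParity t
        ≡⟨ parity-split X clear ⟩
      parity (λ z → X z ∧ clear z) xor parity (λ z → X z ∧ not (clear z))
        ≡⟨ cong₂ _xor_ (parity-cong (λ z → ∧-shuffle (W z) (isAnc t z) (clear z) (oddIn v z)))
                       (parity-partition (λ z → X z ∧ not (clear z)) (hanging t) isAnc covered unique) ⟩
      oddParity (component t) v xor parity (λ q → hanging t q ∧ parity (λ z → isAnc q z ∧ (X z ∧ not (clear z))))
        ≡⟨ cong (oddParity (component t) v xor_) (parity-cong per-hanging) ⟩
      oddParity (component t) v xor parity (λ q → hanging t q ∧ vParity q)
        ∎
      where
      open ≡-Reasoning
      X clear : V F → Bool
      X z = below t z ∧ oddIn v z
      clear z = does (clear? t z)
      covered : ∀ {z} → X z ∧ not (clear z) ≡ true → ∃ λ q → hanging t q ≡ true × isAnc q z ≡ true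
      covered {z} h = q , dec-true (hanging? t q) (proj₁ (proj₂ found)) , ≼⇒isAnc (proj₂ (proj₂ found))
        where
        Xz : X z ≡ true
        Xz = ∧-trueˡ h
        ¬clear : ¬ Clear t z
        ¬clear = does-false⇒ (clear? t z) (not-true (∧-trueʳ {X z} h))
        found : ∃ λ q → Hanging t q × q ≼ z
        found = topmost-ℓ top-t (∧-trueˡ (∧-trueˡ Xz)) (isAnc⇒≼ (∧-trueʳ {W z} (∧-trueˡ Xz))) ¬clear
        q : V F
        q = proj₁ found
      unique : ∀ {z q q'} → _ → hanging t q ≡ true → isAnc q z ≡ true → hanging t q' ≡ true → isAnc q' z ≡ true → q ≡ q'
      unique {z} {q} {q'} _ h q≼z h' q'≼z =
        hanging-unique (does⇒ (hanging? t q) h) (does⇒ (hanging? t q') h') (isAnc⇒≼ q≼z) (isAnc⇒≼ q'≼z)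
      per-hanging : ∀ q → hanging t q ∧ parity (λ z → isAnc q z ∧ (X z ∧ not (clear z))) ≡ hanging t q ∧ vParity q
      per-hanging q = ∧-cong-true (hanging t q) λ h → parity-cong (pointwise h)
        where
        pointwise : hanging t q ≡ true → ∀ z → isAnc q z ∧ (X z ∧ not (clear z)) ≡ below q z ∧ oddIn v z
        pointwise h z = by-cases (q ≼? z)
          where
          outside : ∀ {a x} → a ≡ false → a ∧ x ≡ (W z ∧ a) ∧ oddIn v z
          outside refl = cong (_∧ oddIn v z) (sym (∧-zeroʳ (W z)))
          inside : ∀ {a b c} → a ≡ true → b ≡ true → c ≡ false →
            a ∧ (((W z ∧ b) ∧ oddIn v z) ∧ not c) ≡ (W z ∧ a) ∧ oddIn v z
          inside refl refl refl = ∧-identityʳ _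
          H : Hanging t q
          H = does⇒ (hanging? t q) h
          by-cases : Dec (q ≼ z) → isAnc q z ∧ (X z ∧ not (clear z)) ≡ below q z ∧ oddIn v z
          by-cases (no q⋠z) = outside (⋠⇒isAnc q⋠z)
          by-cases (yes q≼z) = inside (≼⇒isAnc q≼z) (≼⇒isAnc (≼-trans (hanging-below H) q≼z))
            (dec-false (clear? t z) (λ clr → false≢true (clr q (hanging-below H) q≼z) (proj₁ (proj₂ H))))

    odd-ℓ-below : ∀ {q} → W q ≡ true → onℓ q ≡ true → q ≢ ys → vParity q ≡ false →
      ∃ λ y → below q y ∧ oddIn ℓ y ≡ true
    odd-ℓ-below {q} Wq ℓq q≢ys even = parity-witness _ (subst (λ b → b xor oddParity (below q) ℓ ≡ true) even differ)
      where
      q⋠pq : ¬ q ≼ par q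
      q⋠pq q≼pq = <-irrefl refl (≤-<-trans (≼-depth q≼pq) (≼-depth-< (par-≼ q≢ys) (par≢ q≢ys)))
      exit-edge : over v ℓ q (par q) ≡ true
      exit-edge = over-intro (par-adj q≢ys) (==⇒≡ (φ q) ℓ ℓq) (parent-of-ℓ Wq ℓq q≢ys)
      exits : ∀ {z y} → below q z ≡ true → over v ℓ z y ≡ true → below q y ≡ false → z ≡ q × y ≡ par q
      exits {z} {y} in-z o out-y with over⇒ o
      ... | e , fibre = edge-leaving-subtree e (isAnc⇒≼ (∧-trueʳ {W z} in-z))
                          (λ q≼y → false≢true out-y (∧-true (closed (∧-trueˡ in-z) e (U-fibre fibre)) (≼⇒isAnc q≼y)))
        where
        U-fibre : φ y ≡ ℓ ⊎ φ y ≡ v → U (φ y) ≡ true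
        U-fibre (inj₁ p) = subst (λ u → U u ≡ true) (sym p) Uℓ
        U-fibre (inj₂ p) = subst (λ u → U u ≡ true) (sym p) Uv
      differ : oddParity (below q) v xor oddParity (below q) ℓ ≡ true
      differ = single-exit⇒parity-differ (below q) (adjᴳ-sym ℓv) (∧-true Wq (≼⇒isAnc ≼-refl)) exit-edge
                 (trans (cong (W (par q) ∧_) (⋠⇒isAnc q⋠pq)) (∧-zeroʳ _)) exits

    child-of-ℓ-is-top : ∀ {q c} → onℓ q ≡ true → Child q c → Top c
    child-of-ℓ-is-top ℓq (Wc , c≢ys , pc≡q) = Wc , c≢ys , subst (λ x → onℓ x ≡ true) (sym pc≡q) ℓq

    private
      top : V F → Bool
      top t = does (top? t)

      vParity-root : vParity ys ≡ true
      vParity-root = trans (parity-cong below-root) (odd-fibres Uv)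
        where
        below-root : ∀ z → below ys z ∧ oddIn v z ≡ W z ∧ oddIn v z
        below-root z = trans (cong (λ b → (W z ∧ b) ∧ oddIn v z) (≼⇒isAnc (root-≼ z)))
                             (cong (_∧ oddIn v z) (∧-identityʳ (W z)))

      some-odd-top : ∃ λ c → top c ∧ vParity c ≡ true
      some-odd-top = c , ∧-true (dec-true (top? c) (child-of-ℓ-is-top (∧-trueˡ ys-odd) (does⇒ (child? ys c) (∧-trueˡ odd-child))))
                                (∧-trueʳ {child ys c} odd-child)
        where
        found : ∃ λ c → child ys c ∧ vParity c ≡ true
        found = parity-witness _ (trans (sym (vParity-ℓ (∧-trueˡ ys-odd))) vParity-root)
        c : V F
        c = proj₁ found
        odd-child : child ys c ∧ vParity c ≡ true
        odd-child = proj₂ found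

      deepest-odd-top : ∃ λ t → top t ∧ vParity t ≡ true × (∀ c → top c ∧ vParity c ≡ true → depth c ≤ depth t)
      deepest-odd-top = argmax (λ t → top t ∧ vParity t) depth (proj₂ some-odd-top)

    -- Maximality of t makes every ℓ-vertex hanging below its component even (hanging-even),
    -- which forces the component itself to be odd (component-odd).
    opaque
      t : V F
      t = proj₁ deepest-odd-top

      top-t : Top t
      top-t = does⇒ (top? t) (∧-trueˡ (proj₁ (proj₂ deepest-odd-top)))

      t-odd : vParity t ≡ true
      t-odd = ∧-trueʳ {top t} (proj₁ (proj₂ deepest-odd-top))

      t-deepest : ∀ {c} → Top c → vParity c ≡ true → depth c ≤ depth t
      t-deepest {c} top-c odd-c = proj₂ (proj₂ deepest-odd-top) c (∧-true (dec-true (top? c) top-c) odd-c)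

    hanging-even : ∀ {q} → Hanging t q → vParity q ≡ false
    hanging-even {q} (_ , ℓq , q≢ys , _ , t≼pq , _) = trans (vParity-ℓ ℓq) (parity-none no-odd-child)
      where
      no-odd-child : ∀ c → child q c ∧ vParity c ≡ false
      no-odd-child c = ¬true λ h → <-irrefl refl (<-≤-trans (t<c (∧-trueˡ h))
                         (t-deepest (child-of-ℓ-is-top ℓq (does⇒ (child? q c) (∧-trueˡ h))) (∧-trueʳ {child q c} h)))
        where
        t<c : child q c ≡ true → depth t < depth c
        t<c ch = ≤-<-trans (≼-depth t≼pq)
                   (≤-trans (≼-depth-< (par-≼ q≢ys) (par≢ q≢ys))
                            (≤-trans (n≤1+n _) (≤-reflexive (sym (depth-child (proj₂ (does⇒ (child? q c) ch)))))))

    component-odd : oddParity (component t) v ≡ true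
    component-odd = begin
      oddParity (component t) v
        ≡⟨ xor-identityʳ _ ⟨
      oddParity (component t) v xor false
        ≡⟨ cong (oddParity (component t) v xor_) (parity-none no-odd-hanging) ⟨
      oddParity (component t) v xor parity (λ q → hanging t q ∧ vParity q)
        ≡⟨ vParity-top top-t ⟨
      vParity t
        ≡⟨ t-odd ⟩
      true
        ∎
      where
      open ≡-Reasoning
      no-odd-hanging : ∀ q → hanging t q ∧ vParity q ≡ false
      no-odd-hanging q = ¬true λ h → false≢true (hanging-even (does⇒ (hanging? t q) (∧-trueˡ h))) (∧-trueʳ {hanging t q} h)

    pruned : V F → Bool
    pruned = component t

    pruned-region : Region U' pruned
    pruned-region = component-region top-t component-odd

    U'v : U' v ≡ true
    U'v = ∧-true Uv (not-false (≢⇒==-false (λ v≡ℓ → ℓ≢v (sym v≡ℓ))))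

    module _ (E : Embedding U' pruned) where

      private
        module E = Embedding E

      a : V F
      a = E.ρ v

      a-in : InComponent t a
      a-in = component⇒ (E.ρ-in U'v)

      record PendantPath : Set where
        field
          y : V F
          W-y : W y ≡ true
          y-odd : oddIn ℓ y ≡ true
          path : Path F a y
          path-in : ∀ {x} → x ∈ verts (walk path) → W x ≡ true
          path-outside : ∀ {x} → x ∈ verts (walk path) → x ≢ a → pruned x ≡ false

      up-to-root : a ≡ t → PendantPath
      up-to-root a≡t = record
        { y = ys ; W-y = W-ys ; y-odd = ys-odd ; path = proj₁ climb
        ; path-in = λ m → W-≼ (proj₁ a-in) (proj₂ (proj₂ climb m))
        ; path-outside = λ m x≢a → ¬true (λ cx → x≢a (above-t (proj₂ (proj₂ climb m)) (proj₁ (proj₂ (component⇒ cx)))))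
        }
        where
        climb : Σ (Path F a ys) λ P → ∀ {x} → x ∈ verts (walk P) → ys ≼ x × x ≼ a
        climb = ascent (root-≼ a)
        above-t : ∀ {x} → x ≼ a → t ≼ x → x ≡ a
        above-t x≼a t≼x = ≼-depth-≡ x≼a (≤-antisym (≼-depth x≼a) (subst (λ s → depth s ≤ _) (sym a≡t) (≼-depth t≼x)))

      through-hanging : ∀ {y₁} → Hanging t y₁ → par y₁ ≡ a → PendantPath
      through-hanging {y₁} H@(W-y₁ , ℓy₁ , y₁≢ys , _) py₁≡a = record
        { y = y ; W-y = W-y ; y-odd = ∧-trueʳ {below y₁ y} (proj₂ found) ; path = proj₁ descend
        ; path-in = λ m → W-≼ W-y (proj₂ (proj₂ descend m))
        ; path-outside = λ m x≢a → ¬true (λ cx → beyond-y₁ (proj₂ descend m) x≢a (component⇒ cx))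
        }
        where
        found : ∃ λ y → below y₁ y ∧ oddIn ℓ y ≡ true
        found = odd-ℓ-below W-y₁ ℓy₁ y₁≢ys (hanging-even H)
        y : V F
        y = proj₁ found
        W-y : W y ≡ true
        W-y = ∧-trueˡ (∧-trueˡ (proj₂ found))
        a≼y₁ : a ≼ y₁
        a≼y₁ = subst (_≼ y₁) py₁≡a (par-≼ y₁≢ys)
        y₁≼y : y₁ ≼ y
        y₁≼y = isAnc⇒≼ (∧-trueʳ {W y} (∧-trueˡ (proj₂ found)))
        descend : Σ (Path F a y) λ P → ∀ {x} → x ∈ verts (walk P) → a ≼ x × x ≼ y
        descend = descent (≼-trans a≼y₁ y₁≼y)
        beyond-y₁ : ∀ {x} → a ≼ x × x ≼ y → x ≢ a → ¬ InComponent t x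
        beyond-y₁ {x} (a≼x , x≼y) x≢a (_ , t≼x , clear) =
          false≢true (clear y₁ (hanging-below H) (≼-by-depth y₁≼y x≼y y₁≤x)) ℓy₁
          where
          y₁≤x : depth y₁ ≤ depth x
          y₁≤x = subst (_≤ depth x) (sym (trans (depth-par y₁≢ys) (cong (λ s → suc (depth s)) py₁≡a)))
                   (≼-depth-< a≼x (λ a≡x → x≢a (sym a≡x)))

      down-to-odd-ℓ : a ≢ t → PendantPath
      down-to-odd-ℓ a≢t = by-orientation (edge-parent e)
        where
        found : ∃ λ y₁ → Adj F a y₁ × φ y₁ ≡ ℓ
        found = odd⇒neighbour-in-fibre (E.ρ-odd U'v) (subst (λ x → Adj G x ℓ) (sym (E.ρ-fibre U'v)) (adjᴳ-sym ℓv))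
        y₁ : V F
        y₁ = proj₁ found
        e : Adj F a y₁
        e = proj₁ (proj₂ found)
        ℓy₁ : onℓ y₁ ≡ true
        ℓy₁ = ≡⇒== (proj₂ (proj₂ found))
        by-orientation : ParentEdge a y₁ ⊎ ParentEdge y₁ a → PendantPath
        by-orientation (inj₁ (a≢ys , pa≡y₁)) =
          ⊥-elim (false≢true (component-off-ℓ pa-in) (subst (λ x → onℓ x ≡ true) (sym pa≡y₁) ℓy₁))
          where
          pa-in = component-between a-in (par-≼ a≢ys) (≼-par (proj₁ (proj₂ a-in)) (λ t≡a → a≢t (sym t≡a)))
        by-orientation (inj₂ (y₁≢ys , py₁≡a)) =
          through-hanging (W-y₁ , ℓy₁ , y₁≢ys , subst (InComponent t) (sym py₁≡a) a-in) py₁≡a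
          where
          W-y₁ = closed (proj₁ a-in) e (subst (λ u → U u ≡ true) (sym (proj₂ (proj₂ found))) Uℓ)

      pendant-path : PendantPath
      pendant-path = by-position (a ≟ t)
        where
        by-position : Dec (a ≡ t) → PendantPath
        by-position (yes a≡t) = up-to-root a≡t
        by-position (no a≢t) = down-to-odd-ℓ a≢t

      extend : Embedding U W
      extend = PendantExtension.extended pendant U'v (λ cz → proj₁ (component⇒ cz)) E W-y y-odd path path-in path-outside
        where open PendantPath pendant-path

module Minor (F G : Graph) (φ : V F → V G) (odm : IsOddomorphism F G φ)
             (conn : Connected F) (acyclic : ¬ HasCycle F) where

  open Oddomorphism F G φ odm
  open Embeddings F G φ odm
  open Pruning F G φ odm conn acyclic
  open Walks G using (adj-irrefl)
  open IsOddomorphism odm using (hom; fibreOdd)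

  module Farthest {U W} (R : Region U W) {z₁} (Wz₁ : W z₁ ≡ true) where

    open Region R
    open RootedTree F conn acyclic z₁

    private
      farthest : ∃ λ x → W x ≡ true × (∀ y → W y ≡ true → depth y ≤ depth x)
      farthest = argmax W depth Wz₁

    x : V F
    x = proj₁ farthest

    single : x ≡ z₁ → ∀ {z} → W z ≡ true → z ≡ z₁
    single x≡z₁ Wz = depth≡0⇒root (n≤0⇒n≡0 (≤-trans (proj₂ (proj₂ farthest) _ Wz)
                                                    (≤-reflexive (trans (cong depth x≡z₁) depth-root))))

    module _ (x≢z₁ : x ≢ z₁) where

      private
        Wx : W x ≡ true
        Wx = proj₁ (proj₂ farthest)

        W-px : W (par x) ≡ true
        W-px = parent-closed W connected Wz₁ Wx x≢z₁

        only-W-neighbour : ∀ {y} → W y ≡ true → Adj F x y → y ≡ par x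
        only-W-neighbour Wy e with edge-parent e
        ... | inj₁ (_ , px≡y) = sym px≡y
        ... | inj₂ (y≢z₁ , py≡x) =
          contradiction (proj₂ (proj₂ farthest) _ Wy)
            (λ y≤x → <-irrefl refl (≤-<-trans y≤x (≼-depth-< (subst (_≼ _) py≡x (par-≼ y≢z₁))
                                                             (λ x≡y → par≢ y≢z₁ (trans py≡x x≡y)))))

        x-odd : isOdd x ≡ true
        x-odd = trans (sym (neighbour-parity (hom x (par x) (par-adj x≢z₁))))
                      (trans (parity-single (par x) others) (∧-true (par-adj x≢z₁) (==-refl (φ (par x)))))
          where
          others : ∀ b → b ≢ par x → adj F x b ∧ (φ b == φ (par x)) ≡ false
          others b b≢px = ¬true λ h → b≢px (only-W-neighbour
            (closed Wx (∧-trueˡ h) (subst (λ u → U u ≡ true) (sym (==⇒≡ (φ b) _ (∧-trueʳ {adj F x b} h))) (image W-px)))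
            (∧-trueˡ h))

      pendant-vertex : PendantVertex U
      pendant-vertex = record
        { ℓ = φ x ; v = φ (par x) ; ℓv = hom x (par x) (par-adj x≢z₁) ; Uℓ = image Wx ; Uv = image W-px
        ; pendant = λ Uu e → pendant Uu e
        }
        where
        pendant : ∀ {u} → U u ≡ true → Adj G (φ x) u → u ≡ φ (par x)
        pendant Uu e with odd⇒neighbour-in-fibre x-odd e
        ... | y , xy , φy≡u = trans (sym φy≡u)
                (cong φ (only-W-neighbour (closed Wx xy (subst (λ u → U u ≡ true) (sym φy≡u) Uu)) xy))

  singleton-embedding : ∀ {U W} → Region U W → ∀ {z₁} → W z₁ ≡ true → isOdd z₁ ≡ true →
    (∀ {z} → W z ≡ true → z ≡ z₁) → Embedding U W
  singleton-embedding {U} {W} R {z₁} Wz₁ odd only = record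
    { ρ = λ _ → z₁
    ; ρ-in = λ _ → Wz₁
    ; ρ-fibre = fibre
    ; ρ-odd = λ _ → odd
    ; path = λ _ e Uv Uw → no-edge e Uv Uw
    ; path-in = λ _ e Uv Uw → no-edge e Uv Uw
    ; avoids-branches = λ _ e Uv Uw → no-edge e Uv Uw
    ; disjoint = λ _ e Uv Uw → no-edge e Uv Uw
    }
    where
    fibre : ∀ {u} → U u ≡ true → φ z₁ ≡ u
    fibre {u} Uu with parity-witness _ (Region.odd-fibres R Uu)
    ... | z , h = trans (cong φ (sym (only (∧-trueˡ h)))) (==⇒≡ (φ z) u (∧-trueˡ (∧-trueʳ {W z} h)))
    no-edge : ∀ {A : Set} {v w} → Adj G v w → U v ≡ true → U w ≡ true → A
    no-edge e Uv Uw = contradiction (subst (Adj G _) (trans (sym (fibre Uw)) (fibre Uv)) e) adj-irrefl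

  embed : ∀ m {U W} → count (n G) U ≡ m → Region U W → ∀ {u₀} → U u₀ ≡ true → Embedding U W
  embed m {U} {W} size R Uu₀ = by-shape (x ≟ z₁)
    where
    some-odd : ∃ λ z → W z ∧ oddIn _ z ≡ true
    some-odd = parity-witness _ (Region.odd-fibres R Uu₀)
    z₁ : V F
    z₁ = proj₁ some-odd
    W-z₁ : W z₁ ≡ true
    W-z₁ = ∧-trueˡ (proj₂ some-odd)
    open Farthest R W-z₁
    prune : ∀ m → count (n G) U ≡ m → PendantVertex U → Embedding U W
    prune m size P = shrink m (trans (sym size) (count-remove (n G) U ℓ Uℓ))
      where
      open PendantVertex P
      shrink : ∀ m → m ≡ suc (count (n G) (U' R P)) → Embedding U W
      shrink zero ()
      shrink (suc m) smaller = extend R P (embed m (suc-injective (sym smaller)) (pruned-region R P) (U'v R P))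
    by-shape : Dec (x ≡ z₁) → Embedding U W
    by-shape (yes x≡z₁) =
      singleton-embedding R W-z₁ (∧-trueʳ {φ z₁ == _} (∧-trueʳ {W z₁} (proj₂ some-odd))) (single x≡z₁)
    by-shape (no x≢z₁) = prune m size (pendant-vertex x≢z₁)

  whole-region : Region (λ _ → true) (λ _ → true)
  whole-region = record
    { image = λ _ → refl
    ; closed = λ _ _ _ → refl
    ; connected = λ {z} {z'} _ _ → conn z z' , λ _ → refl
    ; odd-fibres = λ {u} _ → trans (parity-cong (λ a → cong ((φ a == u) ∧_) (isOdd-isOddVtx a)))
                                   (trans (sym (oddB-count (n F) _)) (fibreOdd u))
    }

lemma4p6 : (F G : Graph) (φ : V F → V G) →
    IsOddomorphism F G φ → IsTree F → IsTopologicalMinor G F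
lemma4p6 F G φ odm (nonempty , conn , acyclic) = record
  { ρ = ρ
  ; ρ-inj = λ {u} {u'} ρu≡ρu' → trans (sym (ρ-fibre refl)) (trans (cong φ ρu≡ρu') (ρ-fibre refl))
  ; P = λ v w o e → path o e refl refl
  ; innerAvoidsBranch = λ v w o e u → avoids-branches o e refl refl refl
  ; innerDisjoint = λ v w o e v' w' o' e' d x → disjoint o e refl refl o' e' refl refl d
  }
  where
  open Minor F G φ odm conn acyclic
  open Embeddings F G φ odm
  open Embedding (embed _ refl whole-region {φ (fromℕ< nonempty)} refl)
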